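{- Let $F$ be a finite field and $n\ge1$. Then the number of double cosets $|SL_n(F)\backslash M_n(F)/SL_n(F)|$, i.e. of equivalence classes of $M_n(F)$ under $A\sim B\iff A=PBQ$ for some $P,Q\in SL_n(F)$, equals $n+|F|-1$. -}

module Defs where

open import Level using (Level; _⊔_)
open import Data.Nat using (ℕ; zero; suc)
open import Data.Fin using (Fin; zero; suc; punchIn)
open import Data.Product using (Σ; ∃; _×_; _,_)
open import Relation.Binary.PropositionalEquality using (_≡_)
open import Relation.Nullary using (¬_)
open import Algebra.Bundles using (CommutativeRing)

record Field (c ℓ : Level) : Set (Level.suc (c ⊔ ℓ)) where
  field
    commutativeRing : CommutativeRing c ℓ
  open CommutativeRing commutativeRing public
  field
    0≉1     : ¬ (0# ≈ 1#)
    inverse : ∀ x → ¬ (x ≈ 0#) → ∃ λ y → (x * y) ≈ 1#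

record IsFiniteOfSize {c ℓ} (F : Field c ℓ) (q : ℕ) : Set (c ⊔ ℓ) where
  open Field F using (Carrier; _≈_; _+_; _*_; -_; 0#; 1#)
  field
    enum       : Fin q → Carrier
    enum-inj   : ∀ i j → enum i ≈ enum j → i ≡ j
    enum-surj  : ∀ x → ∃ λ i → enum i ≈ x

module MatrixOps {c ℓ} (F : Field c ℓ) where
  open Field F using (Carrier; _≈_; _+_; _*_; -_; 0#; 1#)

  Matrix : ℕ → Set c
  Matrix n = Fin n → Fin n → Carrier

  _≈ᴹ_ : ∀ {n} → Matrix n → Matrix n → Set ℓ
  A ≈ᴹ B = ∀ i j → A i j ≈ B i j

  sumF : ∀ n → (Fin n → Carrier) → Carrier
  sumF zero    f = 0#
  sumF (suc n) f = f zero + sumF n (λ k → f (suc k))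

  _⊗_ : ∀ {n} → Matrix n → Matrix n → Matrix n
  _⊗_ {n} A B i j = sumF n (λ k → A i k * B k j)

  minor : ∀ {n} → Matrix (suc n) → Fin (suc n) → Matrix n
  minor A j r s = A (suc r) (punchIn j s)

  altSum : ∀ n → (Fin n → Carrier) → Carrier
  altSum zero    f = 0#
  altSum (suc n) f = f zero + (- altSum n (λ k → f (suc k)))

  det : ∀ n → Matrix n → Carrier
  det zero    A = 1#
  det (suc n) A = altSum (suc n) (λ j → A zero j * det n (minor A j))

  IsSL : ∀ {n} → Matrix n → Set ℓ
  IsSL {n} P = det n P ≈ 1#

  SLEquiv : ∀ {n} → Matrix n → Matrix n → Set (c ⊔ ℓ)
  SLEquiv {n} A B = Σ (Matrix n) λ P → Σ (Matrix n) λ Q →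
    IsSL P × IsSL Q × (A ≈ᴹ ((P ⊗ B) ⊗ Q))

  -- The set of equivalence classes of M_n(F) under SLEquiv has exactly k
  -- elements: k pairwise inequivalent representatives covering everything.
  NumClasses : ℕ → ℕ → Set (c ⊔ ℓ)
  NumClasses n k = Σ (Fin k → Matrix n) λ rep →
    (∀ A → ∃ λ i → SLEquiv A (rep i)) ×
    (∀ i j → SLEquiv (rep i) (rep j) → i ≡ j)

{-# OPTIONS --safe #-}
-- Multiplying by transvections, which have determinant 1, and rescaling a pivot by
-- diag(p, p⁻¹, 1, …, 1) reduces every n × n matrix to E r = diag(1, …, 1, 0, …, 0) with
-- r < n ones, or to D d = diag(1, …, 1, d) with d ≠ 0: n + (|F| - 1) candidates.
-- The determinant is invariant under SL_n-equivalence; it tells the D d apart from each other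
-- and from the singular E r.  The E r are told apart by rank: from E s = P (E r) Q with r < s
-- one builds a matrix with a zero column and a right inverse.
-- Multiplicativity of the Laplace-expansion determinant is proved by induction on n: row
-- reduction of A shows det (A X) = κ * det X for a κ independent of X.
module Submission where

open import Defs
open import Level using (_⊔_)
open import Algebra.Bundles using (CommutativeRing)
open import Data.Empty using (⊥-elim)
open import Data.Fin.Base using (Fin; zero; suc; punchIn; punchOut; lift; toℕ; fromℕ<; splitAt; join)
import Data.Fin.Properties as Fin
open import Data.Fin.Properties using (all?; ¬∀⟶∃¬)
open import Data.Integer.Base as ℤ using (ℤ; +_; -[1+_]; _⊖_; sign; ∣_∣)
import Data.Integer.Properties as ℤ
open import Data.Maybe.Base as Maybe using (Maybe)
open import Data.Nat.Base as ℕ using (ℕ; zero; suc; z≤n; s≤s; _≤_; _<_)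
import Data.Nat.Properties as ℕ
open import Data.Product.Base using (∃; ∃₂; _×_; _,_; proj₁; proj₂)
open import Data.Sign.Base as Sign using (Sign)
open import Data.Sum.Base using (_⊎_; inj₁; inj₂)
open import Data.Vec.Functional using (_∷_; tail; updateAt)
open import Data.Vec.Functional.Properties using (updateAt-updates; updateAt-minimal)
open import Function.Base using (_∘_; const)
open import Relation.Binary.Bundles using (Setoid)
open import Relation.Binary.Definitions using (Decidable; tri<; tri≈; tri>)
open import Relation.Binary.PropositionalEquality as ≡ using (_≡_; _≢_)
open import Relation.Binary.Structures using (IsEquivalence)
import Relation.Binary.Reasoning.Setoid as SetoidReasoning
open import Relation.Nullary using (¬_; yes; no; contradiction)
open import Relation.Nullary.Decidable using (dec⇒maybe; map′)

module IntegerCoefficientSolver {c ℓ} (R : CommutativeRing c ℓ) where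
  open CommutativeRing R
  open import Algebra.Properties.Semiring.Mult.TCOptimised semiring
    using (1+×; ×-homo-+; ×1-homo-*) renaming (_×_ to _×ₙ_)
  open import Algebra.Properties.Ring ring using (-1*x≈-x)
  open import Algebra.Properties.AbelianGroup +-abelianGroup using (⁻¹-∙-comm)
  open import Algebra.Properties.Group +-group using (⁻¹-involutive; ε⁻¹≈ε)
  open import Algebra.Properties.CommutativeSemigroup +-commutativeSemigroup
    using () renaming (interchange to +-interchange)
  open import Algebra.Properties.CommutativeSemigroup *-commutativeSemigroup
    using () renaming (interchange to *-interchange)
  open import Algebra.Solver.Ring.AlmostCommutativeRing
    using (AlmostCommutativeRing; fromCommutativeRing; _-Raw-AlmostCommutative⟶_)
  open SetoidReasoning setoid

  private
    fromℤ : ℤ → Carrier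
    fromℤ (+ n)    = n ×ₙ 1#
    fromℤ -[1+ n ] = - (suc n ×ₙ 1#)

    x+y-[x+z]≈y-z : ∀ a x y → (a + x) - (a + y) ≈ x - y
    x+y-[x+z]≈y-z a x y = begin
      (a + x) - (a + y)     ≈⟨ +-congˡ (⁻¹-∙-comm a y) ⟨
      (a + x) + (- a - y)   ≈⟨ +-interchange a x (- a) (- y) ⟩
      (a - a) + (x - y)     ≈⟨ +-congʳ (-‿inverseʳ a) ⟩
      0# + (x - y)          ≈⟨ +-identityˡ (x - y) ⟩
      x - y                 ∎

    fromℤ-⊖ : ∀ m n → fromℤ (m ⊖ n) ≈ m ×ₙ 1# - n ×ₙ 1#
    fromℤ-⊖ zero    zero    = sym (-‿inverseʳ 0#)
    fromℤ-⊖ zero    (suc n) = sym (+-identityˡ _)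
    fromℤ-⊖ (suc m) zero    = sym (trans (+-congˡ ε⁻¹≈ε) (+-identityʳ _))
    fromℤ-⊖ (suc m) (suc n) = begin
      fromℤ (suc m ⊖ suc n)              ≡⟨ ≡.cong fromℤ (ℤ.[1+m]⊖[1+n]≡m⊖n m n) ⟩
      fromℤ (m ⊖ n)                      ≈⟨ fromℤ-⊖ m n ⟩
      m ×ₙ 1# - n ×ₙ 1#                  ≈⟨ x+y-[x+z]≈y-z 1# (m ×ₙ 1#) (n ×ₙ 1#) ⟨
      (1# + m ×ₙ 1#) - (1# + n ×ₙ 1#)    ≈⟨ +-cong (1+× m 1#) (-‿cong (1+× n 1#)) ⟨
      suc m ×ₙ 1# - suc n ×ₙ 1#          ∎

    fromℤ-+ : ∀ i j → fromℤ (i ℤ.+ j) ≈ fromℤ i + fromℤ j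
    fromℤ-+ -[1+ m ] -[1+ n ] = trans (-‿cong (begin
      suc (suc (m ℕ.+ n)) ×ₙ 1#     ≡⟨ ≡.cong (λ k → suc k ×ₙ 1#) (ℕ.+-suc m n) ⟨
      (suc m ℕ.+ suc n) ×ₙ 1#       ≈⟨ ×-homo-+ 1# (suc m) (suc n) ⟩
      suc m ×ₙ 1# + suc n ×ₙ 1#     ∎)) (sym (⁻¹-∙-comm _ _))
    fromℤ-+ -[1+ m ] (+ n)    = trans (fromℤ-⊖ n (suc m)) (+-comm _ _)
    fromℤ-+ (+ m)    -[1+ n ] = fromℤ-⊖ m (suc n)
    fromℤ-+ (+ m)    (+ n)    = ×-homo-+ 1# m n

    fromℤ-neg : ∀ i → fromℤ (ℤ.- i) ≈ - fromℤ i
    fromℤ-neg -[1+ n ]  = sym (⁻¹-involutive _)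
    fromℤ-neg (+ zero)  = sym ε⁻¹≈ε
    fromℤ-neg (+ suc n) = refl

    fromSign : Sign → Carrier
    fromSign Sign.+ = 1#
    fromSign Sign.- = - 1#

    fromSign-* : ∀ s t → fromSign (s Sign.* t) ≈ fromSign s * fromSign t
    fromSign-* Sign.- Sign.- = sym (trans (-1*x≈-x _) (⁻¹-involutive _))
    fromSign-* Sign.- Sign.+ = sym (*-identityʳ _)
    fromSign-* Sign.+ t      = sym (*-identityˡ _)

    fromℤ-◃ : ∀ s n → fromℤ (s ℤ.◃ n) ≈ fromSign s * n ×ₙ 1#
    fromℤ-◃ s      zero    = sym (zeroʳ _)
    fromℤ-◃ Sign.+ (suc n) = sym (*-identityˡ _)
    fromℤ-◃ Sign.- (suc n) = sym (-1*x≈-x _)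

    fromℤ-signAbs : ∀ i → fromℤ i ≈ fromSign (sign i) * ∣ i ∣ ×ₙ 1#
    fromℤ-signAbs -[1+ n ] = sym (-1*x≈-x _)
    fromℤ-signAbs (+ n)    = sym (*-identityˡ _)

    fromℤ-* : ∀ i j → fromℤ (i ℤ.* j) ≈ fromℤ i * fromℤ j
    fromℤ-* i j = begin
      fromℤ (i ℤ.* j)
        ≈⟨ fromℤ-◃ (sign i Sign.* sign j) (∣ i ∣ ℕ.* ∣ j ∣) ⟩
      fromSign (sign i Sign.* sign j) * (∣ i ∣ ℕ.* ∣ j ∣) ×ₙ 1#
        ≈⟨ *-cong (fromSign-* (sign i) (sign j)) (×1-homo-* ∣ i ∣ ∣ j ∣) ⟩
      (fromSign (sign i) * fromSign (sign j)) * (∣ i ∣ ×ₙ 1# * ∣ j ∣ ×ₙ 1#)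
        ≈⟨ *-interchange _ _ _ _ ⟩
      (fromSign (sign i) * ∣ i ∣ ×ₙ 1#) * (fromSign (sign j) * ∣ j ∣ ×ₙ 1#)
        ≈⟨ *-cong (fromℤ-signAbs i) (fromℤ-signAbs j) ⟨
      fromℤ i * fromℤ j ∎

    almostCommutativeRing : AlmostCommutativeRing c ℓ
    almostCommutativeRing = fromCommutativeRing R

    fromℤ-homomorphism : CommutativeRing.rawRing ℤ.+-*-commutativeRing
                           -Raw-AlmostCommutative⟶ almostCommutativeRing
    fromℤ-homomorphism = record
      { ⟦_⟧ = fromℤ ; +-homo = fromℤ-+ ; *-homo = fromℤ-* ; -‿homo = fromℤ-neg
      ; 0-homo = refl ; 1-homo = refl }

    fromℤ-≟ : ∀ i j → Maybe (fromℤ i ≈ fromℤ j)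
    fromℤ-≟ i j = Maybe.map (λ { ≡.refl → refl }) (dec⇒maybe (i ℤ.≟ j))

  open import Algebra.Solver.Ring (CommutativeRing.rawRing ℤ.+-*-commutativeRing)
    almostCommutativeRing fromℤ-homomorphism fromℤ-≟ public

module Matrices {c ℓ} (F : Field c ℓ) where
  open Field F hiding (zero)
  open MatrixOps F public
  open IntegerCoefficientSolver commutativeRing public
  open import Algebra.Properties.Group +-group public using () renaming (ε⁻¹≈ε to -0#≈0#)
  open SetoidReasoning setoid

  sumF-cong : ∀ n {f g : Fin n → Carrier} → (∀ k → f k ≈ g k) → sumF n f ≈ sumF n g
  sumF-cong zero    f≈g = refl
  sumF-cong (suc n) f≈g = +-cong (f≈g zero) (sumF-cong n (λ k → f≈g (suc k)))

  sumF-zero : ∀ n (f : Fin n → Carrier) → (∀ k → f k ≈ 0#) → sumF n f ≈ 0#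
  sumF-zero zero    f f≈0 = refl
  sumF-zero (suc n) f f≈0 =
    trans (+-cong (f≈0 zero) (sumF-zero n _ (λ k → f≈0 (suc k)))) (+-identityˡ 0#)

  sumF-+ : ∀ n (f g : Fin n → Carrier) → sumF n (λ k → f k + g k) ≈ sumF n f + sumF n g
  sumF-+ zero    f g = sym (+-identityˡ 0#)
  sumF-+ (suc n) f g = trans (+-congˡ (sumF-+ n _ _))
    (solve 4 (λ a b c d → (a :+ b) :+ (c :+ d) := (a :+ c) :+ (b :+ d)) refl _ _ _ _)

  sumF-*ˡ : ∀ n a (f : Fin n → Carrier) → sumF n (λ k → a * f k) ≈ a * sumF n f
  sumF-*ˡ zero    a f = sym (zeroʳ a)
  sumF-*ˡ (suc n) a f = trans (+-congˡ (sumF-*ˡ n a _)) (sym (distribˡ a _ _))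

  sumF-*ʳ : ∀ n a (f : Fin n → Carrier) → sumF n (λ k → f k * a) ≈ sumF n f * a
  sumF-*ʳ zero    a f = sym (zeroˡ a)
  sumF-*ʳ (suc n) a f = trans (+-congˡ (sumF-*ʳ n a _)) (sym (distribʳ a _ _))

  sumF-swap : ∀ m n (f : Fin m → Fin n → Carrier) →
              sumF m (λ i → sumF n (f i)) ≈ sumF n (λ j → sumF m (λ i → f i j))
  sumF-swap zero    n f = sym (sumF-zero n _ (λ _ → refl))
  sumF-swap (suc m) n f = trans (+-congˡ (sumF-swap m n (λ i → f (suc i)))) (sym (sumF-+ n _ _))

  altSum-cong : ∀ n {f g : Fin n → Carrier} → (∀ k → f k ≈ g k) → altSum n f ≈ altSum n g
  altSum-cong zero    f≈g = refl
  altSum-cong (suc n) f≈g = +-cong (f≈g zero) (-‿cong (altSum-cong n (λ k → f≈g (suc k))))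

  altSum-zero : ∀ n (f : Fin n → Carrier) → (∀ k → f k ≈ 0#) → altSum n f ≈ 0#
  altSum-zero zero    f f≈0 = refl
  altSum-zero (suc n) f f≈0 =
    trans (+-cong (f≈0 zero) (-‿cong (altSum-zero n _ (λ k → f≈0 (suc k)))))
          (trans (+-identityˡ _) -0#≈0#)

  altSum-+ : ∀ n (f g : Fin n → Carrier) → altSum n (λ k → f k + g k) ≈ altSum n f + altSum n g
  altSum-+ zero    f g = sym (+-identityˡ 0#)
  altSum-+ (suc n) f g = trans (+-congˡ (-‿cong (altSum-+ n _ _)))
    (solve 4 (λ a b c d → (a :+ b) :+ :- (c :+ d) := (a :+ :- c) :+ (b :+ :- d)) refl _ _ _ _)

  altSum-*ˡ : ∀ n a (f : Fin n → Carrier) → altSum n (λ k → a * f k) ≈ a * altSum n f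
  altSum-*ˡ zero    a f = sym (zeroʳ a)
  altSum-*ˡ (suc n) a f = trans (+-congˡ (-‿cong (altSum-*ˡ n a _)))
    (solve 3 (λ a b c → a :* b :+ :- (a :* c) := a :* (b :+ :- c)) refl _ _ _)

  altSum-neg : ∀ n (f : Fin n → Carrier) → altSum n (λ k → - f k) ≈ - altSum n f
  altSum-neg zero    f = sym -0#≈0#
  altSum-neg (suc n) f = trans (+-congˡ (-‿cong (altSum-neg n _)))
    (solve 2 (λ a b → :- a :+ :- (:- b) := :- (a :+ :- b)) refl _ _)

  δ : ∀ {n} → Fin n → Fin n → Carrier
  δ zero    zero    = 1#
  δ zero    (suc j) = 0#
  δ (suc i) zero    = 0#
  δ (suc i) (suc j) = δ i j

  I : ∀ {n} → Matrix n
  I = δ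

  sumF-δˡ : ∀ n (i : Fin n) (f : Fin n → Carrier) → sumF n (λ k → δ i k * f k) ≈ f i
  sumF-δˡ (suc n) zero    f =
    trans (+-cong (*-identityˡ _) (sumF-zero n _ (λ k → zeroˡ _))) (+-identityʳ _)
  sumF-δˡ (suc n) (suc i) f = trans (+-cong (zeroˡ _) (sumF-δˡ n i _)) (+-identityˡ _)

  sumF-δʳ : ∀ n (i : Fin n) (f : Fin n → Carrier) → sumF n (λ k → f k * δ k i) ≈ f i
  sumF-δʳ (suc n) zero    f =
    trans (+-cong (*-identityʳ _) (sumF-zero n _ (λ k → zeroʳ _))) (+-identityʳ _)
  sumF-δʳ (suc n) (suc i) f = trans (+-cong (zeroʳ _) (sumF-δʳ n i _)) (+-identityˡ _)

  δ-swap : ∀ {n} (i j : Fin n) (f : Fin n → Carrier) → δ i j * f j ≈ δ i j * f i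
  δ-swap zero    zero    f = refl
  δ-swap zero    (suc j) f = trans (zeroˡ _) (sym (zeroˡ _))
  δ-swap (suc i) zero    f = trans (zeroˡ _) (sym (zeroˡ _))
  δ-swap (suc i) (suc j) f = δ-swap i j (λ k → f (suc k))

  δ-idem : ∀ {n} (i j : Fin n) → δ i j * δ i j ≈ δ i j
  δ-idem zero    zero    = *-identityˡ 1#
  δ-idem zero    (suc j) = zeroˡ 0#
  δ-idem (suc i) zero    = zeroˡ 0#
  δ-idem (suc i) (suc j) = δ-idem i j

  ≈ᴹ-isEquivalence : ∀ {n} → IsEquivalence (_≈ᴹ_ {n})
  ≈ᴹ-isEquivalence = record
    { refl  = λ i j → refl
    ; sym   = λ A≈B i j → sym (A≈B i j)
    ; trans = λ A≈B B≈C i j → trans (A≈B i j) (B≈C i j)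
    }

  matrixSetoid : ℕ → Setoid c ℓ
  matrixSetoid n = record { isEquivalence = ≈ᴹ-isEquivalence {n} }

  module ≈ᴹ-Reasoning {n} = SetoidReasoning (matrixSetoid n)

  ≈ᴹ-refl : ∀ {n} {A : Matrix n} → A ≈ᴹ A
  ≈ᴹ-refl = IsEquivalence.refl ≈ᴹ-isEquivalence

  ≈ᴹ-sym : ∀ {n} {A B : Matrix n} → A ≈ᴹ B → B ≈ᴹ A
  ≈ᴹ-sym = IsEquivalence.sym ≈ᴹ-isEquivalence

  ≈ᴹ-trans : ∀ {n} {A B C : Matrix n} → A ≈ᴹ B → B ≈ᴹ C → A ≈ᴹ C
  ≈ᴹ-trans = IsEquivalence.trans ≈ᴹ-isEquivalence

  ⊗-cong : ∀ {n} {A A′ B B′ : Matrix n} → A ≈ᴹ A′ → B ≈ᴹ B′ → (A ⊗ B) ≈ᴹ (A′ ⊗ B′)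
  ⊗-cong {n} A≈A′ B≈B′ i j = sumF-cong n (λ k → *-cong (A≈A′ i k) (B≈B′ k j))

  ⊗-congˡ : ∀ {n} {A B B′ : Matrix n} → B ≈ᴹ B′ → (A ⊗ B) ≈ᴹ (A ⊗ B′)
  ⊗-congˡ = ⊗-cong ≈ᴹ-refl

  ⊗-congʳ : ∀ {n} {A A′ B : Matrix n} → A ≈ᴹ A′ → (A ⊗ B) ≈ᴹ (A′ ⊗ B)
  ⊗-congʳ A≈A′ = ⊗-cong A≈A′ ≈ᴹ-refl

  ⊗-assoc : ∀ {n} (A B C : Matrix n) → ((A ⊗ B) ⊗ C) ≈ᴹ (A ⊗ (B ⊗ C))
  ⊗-assoc {n} A B C i j = begin
    sumF n (λ l → sumF n (λ k → A i k * B k l) * C l j)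
      ≈⟨ sumF-cong n (λ l → sym (sumF-*ʳ n _ _)) ⟩
    sumF n (λ l → sumF n (λ k → A i k * B k l * C l j))
      ≈⟨ sumF-swap n n _ ⟩
    sumF n (λ k → sumF n (λ l → A i k * B k l * C l j))
      ≈⟨ sumF-cong n (λ k → trans (sumF-cong n (λ l → *-assoc _ _ _)) (sumF-*ˡ n _ _)) ⟩
    sumF n (λ k → A i k * sumF n (λ l → B k l * C l j)) ∎

  ⊗-identityˡ : ∀ {n} (A : Matrix n) → (I ⊗ A) ≈ᴹ A
  ⊗-identityˡ {n} A i j = sumF-δˡ n i (λ k → A k j)

  ⊗-identityʳ : ∀ {n} (A : Matrix n) → (A ⊗ I) ≈ᴹ A
  ⊗-identityʳ {n} A i j = sumF-δʳ n j (A i)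

module Determinants {c ℓ} (F : Field c ℓ) where
  open Field F hiding (zero)
  open Matrices F
  open SetoidReasoning setoid

  det-cong : ∀ n {A B : Matrix n} → A ≈ᴹ B → det n A ≈ det n B
  det-cong zero    A≈B = refl
  det-cong (suc n) A≈B = altSum-cong (suc n) (λ j →
    *-cong (A≈B zero j) (det-cong n (λ r s → A≈B (suc r) (punchIn j s))))

  laplaceTerm : ∀ {n} → Matrix (suc n) → Fin (suc n) → Carrier
  laplaceTerm {n} A j = A zero j * det n (minor A j)

  det-zeroRow : ∀ n (A : Matrix n) i → (∀ s → A i s ≈ 0#) → det n A ≈ 0#
  det-zeroRow (suc n) A zero    Ai≈0 = altSum-zero (suc n) (laplaceTerm A) (λ j →
    trans (*-congʳ (Ai≈0 j)) (zeroˡ _))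
  det-zeroRow (suc n) A (suc i) Ai≈0 = altSum-zero (suc n) (laplaceTerm A) (λ j →
    trans (*-congˡ (det-zeroRow n (minor A j) i (λ s → Ai≈0 _))) (zeroʳ _))

  det-linearInRow : ∀ n (A B C : Matrix n) (i : Fin n) μ →
    (∀ r → r ≢ i → ∀ s → A r s ≈ B r s) → (∀ r → r ≢ i → ∀ s → A r s ≈ C r s) →
    (∀ s → A i s ≈ B i s + μ * C i s) → det n A ≈ det n B + μ * det n C
  det-linearInRow (suc n) A B C i μ A≈B A≈C Ai≈ = begin
    det (suc n) A
      ≈⟨ altSum-cong (suc n) (expansion i A≈B A≈C Ai≈) ⟩
    altSum (suc n) (λ j → laplaceTerm B j + μ * laplaceTerm C j)
      ≈⟨ trans (altSum-+ (suc n) (laplaceTerm B) (λ j → μ * laplaceTerm C j))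
               (+-congˡ (altSum-*ˡ (suc n) μ (laplaceTerm C))) ⟩
    det (suc n) B + μ * det (suc n) C ∎
    where
    expansion : ∀ i → (∀ r → r ≢ i → ∀ s → A r s ≈ B r s) → (∀ r → r ≢ i → ∀ s → A r s ≈ C r s) →
                (∀ s → A i s ≈ B i s + μ * C i s) →
                ∀ j → laplaceTerm A j ≈ laplaceTerm B j + μ * laplaceTerm C j
    expansion zero A≈B A≈C Ai≈ j = begin
      A zero j * det n (minor A j)
        ≈⟨ *-cong (Ai≈ j) (det-cong n (λ r s → A≈B (suc r) (λ ()) _)) ⟩
      (B zero j + μ * C zero j) * det n (minor B j)
        ≈⟨ solve 4 (λ b m c d → (b :+ m :* c) :* d := b :* d :+ m :* (c :* d)) refl _ _ _ _ ⟩
      B zero j * det n (minor B j) + μ * (C zero j * det n (minor B j))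
        ≈⟨ +-congˡ (*-congˡ (*-congˡ (det-cong n (λ r s →
             trans (sym (A≈B (suc r) (λ ()) _)) (A≈C (suc r) (λ ()) _))))) ⟩
      laplaceTerm B j + μ * laplaceTerm C j ∎
    expansion (suc i) A≈B A≈C Ai≈ j = begin
      A zero j * det n (minor A j)
        ≈⟨ *-congˡ (det-linearInRow n (minor A j) (minor B j) (minor C j) i μ
             (λ r r≢i s → A≈B (suc r) (λ e → r≢i (Fin.suc-injective e)) _)
             (λ r r≢i s → A≈C (suc r) (λ e → r≢i (Fin.suc-injective e)) _)
             (λ s → Ai≈ _)) ⟩
      A zero j * (det n (minor B j) + μ * det n (minor C j))
        ≈⟨ solve 4 (λ a x m y → a :* (x :+ m :* y) := a :* x :+ m :* (a :* y)) refl _ _ _ _ ⟩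
      A zero j * det n (minor B j) + μ * (A zero j * det n (minor C j))
        ≈⟨ +-cong (*-congʳ (A≈B zero (λ ()) j)) (*-congˡ (*-congʳ (A≈C zero (λ ()) j))) ⟩
      laplaceTerm B j + μ * laplaceTerm C j ∎

  det-leadingTerm : ∀ n (A : Matrix (suc n)) → altSum n (λ k → laplaceTerm A (suc k)) ≈ 0# →
                    det (suc n) A ≈ A zero zero * det n (minor A zero)
  det-leadingTerm n A tail≈0 = trans (+-congˡ (-‿cong tail≈0)) (trans (+-congˡ -0#≈0#) (+-identityʳ _))

  det-zeroColumn₀ : ∀ n (A : Matrix (suc n)) → (∀ r → A r zero ≈ 0#) → det (suc n) A ≈ 0#
  det-firstColumn : ∀ n (A : Matrix (suc n)) → (∀ r → A (suc r) zero ≈ 0#) →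
                    det (suc n) A ≈ A zero zero * det n (minor A zero)

  det-zeroColumn₀ n A A₀≈0 =
    trans (det-firstColumn n A (λ r → A₀≈0 (suc r))) (trans (*-congʳ (A₀≈0 zero)) (zeroˡ _))

  det-firstColumn zero    A _    = det-leadingTerm zero A refl
  det-firstColumn (suc n) A A₀≈0 = det-leadingTerm (suc n) A
    (altSum-zero (suc n) (λ k → laplaceTerm A (suc k)) (λ k →
      trans (*-congˡ (det-zeroColumn₀ n (minor A (suc k)) A₀≈0)) (zeroʳ _)))

  det-firstRow : ∀ n (A : Matrix (suc n)) → (∀ j → A zero (suc j) ≈ 0#) →
                 det (suc n) A ≈ A zero zero * det n (minor A zero)
  det-firstRow n A A₀ⱼ≈0 = det-leadingTerm n A
    (altSum-zero n (λ k → laplaceTerm A (suc k)) (λ k → trans (*-congʳ (A₀ⱼ≈0 k)) (zeroˡ _)))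

  det-identity : ∀ n → det n I ≈ 1#
  det-identity zero    = refl
  det-identity (suc n) = trans (det-firstColumn n I (λ r → refl))
                               (trans (*-identityˡ _) (det-identity n))

  Columns : ℕ → Set
  Columns m = Fin m → Fin (suc (suc m))

  Extensional : ∀ {m} → (Columns m → Carrier) → Set ℓ
  Extensional {m} g = ∀ (e e′ : Columns m) → (∀ s → e s ≡ e′ s) → g e ≈ g e′

  -- det (2 + m) A unfolds to laplace₂ m (A zero) (A (suc zero)) g, where g e is the
  -- minor of the rows below the first two on the columns e.
  laplace₂ : ∀ m → (x y : Fin (suc (suc m)) → Carrier) → (Columns m → Carrier) → Carrier
  laplace₂ m x y g = altSum (suc (suc m)) (λ j → x j *
    altSum (suc m) (λ k → y (punchIn j k) * g (λ s → punchIn j (punchIn k s))))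

  laplace₁ : ∀ m → (Columns (suc m) → Carrier) → (Fin (suc (suc m)) → Carrier) → Carrier
  laplace₁ m g z = altSum (suc (suc m)) (λ k → z k * g (λ s → suc (punchIn k s)))

  laplace₂-cong : ∀ m {x x′ y y′ : Fin (suc (suc m)) → Carrier} {g g′ : Columns m → Carrier} →
    (∀ s → x s ≈ x′ s) → (∀ s → y s ≈ y′ s) → (∀ e → g e ≈ g′ e) →
    laplace₂ m x y g ≈ laplace₂ m x′ y′ g′
  laplace₂-cong m x≈x′ y≈y′ g≈g′ = altSum-cong (suc (suc m)) (λ j → *-cong (x≈x′ j)
    (altSum-cong (suc m) (λ k → *-cong (y≈y′ (punchIn j k)) (g≈g′ (λ s → punchIn j (punchIn k s))))))

  lift-extensional : ∀ {m} (g : Columns (suc m) → Carrier) → Extensional g →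
                     Extensional (λ e → g (lift 1 e))
  lift-extensional g g-ext e e′ e≗e′ =
    g-ext (lift 1 e) (lift 1 e′) (λ { zero → ≡.refl ; (suc s) → ≡.cong suc (e≗e′ s) })

  laplace₂-suc : ∀ m (x y : Fin (suc (suc (suc m))) → Carrier) (g : Columns (suc m) → Carrier) →
    Extensional g →
    laplace₂ (suc m) x y g ≈ (x zero * laplace₁ m g (tail y) - y zero * laplace₁ m g (tail x))
                             + laplace₂ m (tail x) (tail y) (λ e → g (lift 1 e))
  laplace₂-suc m x y g g-ext = begin
    x zero * laplace₁ m g (tail y) - altSum (suc (suc m)) (λ j → x (suc j) * (y zero * gₛ j - T j))
      ≈⟨ +-congˡ (-‿cong (altSum-cong (suc (suc m)) regroup)) ⟩
    x zero * laplace₁ m g (tail y)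
      - altSum (suc (suc m)) (λ j → y zero * (x (suc j) * gₛ j) + - (x (suc j) * T′ j))
      ≈⟨ +-congˡ (-‿cong (trans
           (altSum-+ (suc (suc m)) (λ j → y zero * (x (suc j) * gₛ j)) (λ j → - (x (suc j) * T′ j)))
           (+-cong (altSum-*ˡ (suc (suc m)) (y zero) (λ j → x (suc j) * gₛ j))
                   (altSum-neg (suc (suc m)) (λ j → x (suc j) * T′ j))))) ⟩
    x zero * laplace₁ m g (tail y) - (y zero * laplace₁ m g (tail x) - laplace₂ m (tail x) (tail y) g₊)
      ≈⟨ solve 3 (λ a b q → a :+ :- (b :+ :- q) := (a :+ :- b) :+ q) refl _ _ _ ⟩
    (x zero * laplace₁ m g (tail y) - y zero * laplace₁ m g (tail x))
      + laplace₂ m (tail x) (tail y) g₊ ∎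
    where
    g₊ : Columns m → Carrier
    g₊ e = g (lift 1 e)
    gₛ : Fin (suc (suc m)) → Carrier
    gₛ j = g (λ s → suc (punchIn j s))
    T : Fin (suc (suc m)) → Carrier
    T j = altSum (suc m) (λ k → y (suc (punchIn j k)) * g (λ s → punchIn (suc j) (punchIn (suc k) s)))
    T′ : Fin (suc (suc m)) → Carrier
    T′ j = altSum (suc m) (λ k → y (suc (punchIn j k)) * g₊ (λ s → punchIn j (punchIn k s)))
    T≈T′ : ∀ j → T j ≈ T′ j
    T≈T′ j = altSum-cong (suc m) (λ k → *-congˡ {y (suc (punchIn j k))} (g-ext
      (λ s → punchIn (suc j) (punchIn (suc k) s)) (lift 1 (λ s → punchIn j (punchIn k s)))
      (λ { zero → ≡.refl ; (suc s) → ≡.refl })))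
    regroup : ∀ j → x (suc j) * (y zero * gₛ j - T j) ≈ y zero * (x (suc j) * gₛ j) + - (x (suc j) * T′ j)
    regroup j = trans (*-congˡ (+-congˡ (-‿cong (T≈T′ j))))
      (solve 4 (λ a b h t → a :* (b :* h :+ :- t) := b :* (a :* h) :+ :- (a :* t)) refl _ _ _ _)

  laplace₂-alternating : ∀ m x (g : Columns m → Carrier) → Extensional g → laplace₂ m x x g ≈ 0#
  laplace₂-alternating zero x g g-ext =
    trans (+-congʳ (*-congˡ (+-congʳ (*-congˡ (g-ext _ _ (λ ()))))))
      (solve 3 (λ a b h → a :* (b :* h :+ :- con (+ 0)) :+ :- (b :* (a :* h :+ :- con (+ 0))
                            :+ :- con (+ 0)) := con (+ 0)) refl _ _ _)
  laplace₂-alternating (suc m) x g g-ext = begin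
    laplace₂ (suc m) x x g
      ≈⟨ laplace₂-suc m x x g g-ext ⟩
    (x zero * laplace₁ m g (tail x) - x zero * laplace₁ m g (tail x))
      + laplace₂ m (tail x) (tail x) (λ e → g (lift 1 e))
      ≈⟨ +-cong (-‿inverseʳ _) (laplace₂-alternating m (tail x) _ (lift-extensional g g-ext)) ⟩
    0# + 0#
      ≈⟨ +-identityˡ 0# ⟩
    0# ∎

  laplace₂-antisymmetric : ∀ m x y (g : Columns m → Carrier) → Extensional g →
                           laplace₂ m x y g + laplace₂ m y x g ≈ 0#
  laplace₂-antisymmetric zero x y g g-ext =
    trans (+-congʳ (+-congʳ (*-congˡ (+-congʳ (*-congˡ (g-ext _ _ (λ ())))))))
      (solve 5 (λ a b c d h →
          (a :* (d :* h :+ :- con (+ 0)) :+ :- (b :* (c :* h :+ :- con (+ 0)) :+ :- con (+ 0)))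
          :+ (c :* (b :* h :+ :- con (+ 0)) :+ :- (d :* (a :* h :+ :- con (+ 0)) :+ :- con (+ 0)))
          := con (+ 0)) refl _ _ _ _ _)
  laplace₂-antisymmetric (suc m) x y g g-ext = begin
    laplace₂ (suc m) x y g + laplace₂ (suc m) y x g
      ≈⟨ +-cong (laplace₂-suc m x y g g-ext) (laplace₂-suc m y x g g-ext) ⟩
    ((a - b) + laplace₂ m (tail x) (tail y) g₊) + ((b - a) + laplace₂ m (tail y) (tail x) g₊)
      ≈⟨ solve 4 (λ a b q r → ((a :+ :- b) :+ q) :+ ((b :+ :- a) :+ r) := q :+ r) refl _ _ _ _ ⟩
    laplace₂ m (tail x) (tail y) g₊ + laplace₂ m (tail y) (tail x) g₊
      ≈⟨ laplace₂-antisymmetric m (tail x) (tail y) g₊ (lift-extensional g g-ext) ⟩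
    0# ∎
    where
    g₊ : Columns m → Carrier
    g₊ e = g (lift 1 e)
    a b : Carrier
    a = x zero * laplace₁ m g (tail y)
    b = y zero * laplace₁ m g (tail x)

  minorsBelow : ∀ m → Matrix (suc (suc m)) → Columns m → Carrier
  minorsBelow m A e = det m (λ r s → A (suc (suc r)) (e s))

  minorsBelow-extensional : ∀ m A → Extensional (minorsBelow m A)
  minorsBelow-extensional m A e e′ e≗e′ =
    det-cong m (λ r s → reflexive (≡.cong (A (suc (suc r))) (e≗e′ s)))

  det-equalRows₀₁ : ∀ m (A : Matrix (suc (suc m))) → (∀ s → A zero s ≈ A (suc zero) s) →
                    det (suc (suc m)) A ≈ 0#
  det-equalRows₀₁ m A A₀≈A₁ = trans
    (laplace₂-cong m {A zero} {A zero} {A (suc zero)} {A zero} {minorsBelow m A}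
                   (λ _ → refl) (λ s → sym (A₀≈A₁ s)) (λ _ → refl))
    (laplace₂-alternating m (A zero) (minorsBelow m A) (minorsBelow-extensional m A))

  swapRows₀₁ : ∀ {n} → Matrix (suc (suc n)) → Matrix (suc (suc n))
  swapRows₀₁ A zero          = A (suc zero)
  swapRows₀₁ A (suc zero)    = A zero
  swapRows₀₁ A (suc (suc r)) = A (suc (suc r))

  det-swapRows₀₁ : ∀ m (A : Matrix (suc (suc m))) →
                   det (suc (suc m)) (swapRows₀₁ A) + det (suc (suc m)) A ≈ 0#
  det-swapRows₀₁ m A =
    laplace₂-antisymmetric m (A (suc zero)) (A zero) (minorsBelow m A) (minorsBelow-extensional m A)

  det-equalRows : ∀ n (k : Fin n) (A : Matrix (suc n)) → (∀ s → A zero s ≈ A (suc k) s) →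
                  det (suc n) A ≈ 0#
  det-equalRows (suc n) zero    A A₀≈Aₖ = det-equalRows₀₁ n A A₀≈Aₖ
  det-equalRows (suc n) (suc k) A A₀≈Aₖ = begin
    det (suc (suc n)) A
      ≈⟨ +-identityˡ _ ⟨
    0# + det (suc (suc n)) A
      ≈⟨ +-congʳ det-swapped≈0 ⟨
    det (suc (suc n)) (swapRows₀₁ A) + det (suc (suc n)) A
      ≈⟨ det-swapRows₀₁ n A ⟩
    0# ∎
    where
    det-swapped≈0 : det (suc (suc n)) (swapRows₀₁ A) ≈ 0#
    det-swapped≈0 = altSum-zero (suc (suc n)) (laplaceTerm (swapRows₀₁ A)) (λ j →
      trans (*-congˡ (det-equalRows n k (minor (swapRows₀₁ A) j) (λ s → A₀≈Aₖ (punchIn j s))))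
            (zeroʳ _))

  det-addRow₀ : ∀ n (A B : Matrix (suc n)) (i : Fin n) μ →
    (∀ r → r ≢ suc i → ∀ s → B r s ≈ A r s) → (∀ s → B (suc i) s ≈ A (suc i) s + μ * A zero s) →
    det (suc n) B ≈ det (suc n) A
  det-addRow₀ n A B i μ B≈A Bᵢ≈ = begin
    det (suc n) B                  ≈⟨ det-linearInRow (suc n) B A C (suc i) μ B≈A B≈C Bᵢ≈′ ⟩
    det (suc n) A + μ * det (suc n) C
      ≈⟨ +-congˡ (trans (*-congˡ det-C≈0) (zeroʳ μ)) ⟩
    det (suc n) A + 0#             ≈⟨ +-identityʳ _ ⟩
    det (suc n) A                  ∎
    where
    C : Matrix (suc n)
    C = updateAt A (suc i) (const (A zero))
    Cᵢ≡A₀ : C (suc i) ≡ A zero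
    Cᵢ≡A₀ = updateAt-updates (suc i) A
    C≡A : ∀ r → r ≢ suc i → C r ≡ A r
    C≡A r r≢i = updateAt-minimal r (suc i) A r≢i
    B≈C : ∀ r → r ≢ suc i → ∀ s → B r s ≈ C r s
    B≈C r r≢i s = trans (B≈A r r≢i s) (reflexive (≡.cong-app (≡.sym (C≡A r r≢i)) s))
    Bᵢ≈′ : ∀ s → B (suc i) s ≈ A (suc i) s + μ * C (suc i) s
    Bᵢ≈′ s = trans (Bᵢ≈ s) (+-congˡ (*-congˡ (reflexive (≡.cong-app (≡.sym Cᵢ≡A₀) s))))
    det-C≈0 : det (suc n) C ≈ 0#
    det-C≈0 = det-equalRows n i C (λ s →
      reflexive (≡.cong-app (≡.trans (C≡A zero (λ ())) (≡.sym Cᵢ≡A₀)) s))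

  addRows₀ : ∀ {n} → Matrix (suc n) → (Fin n → Carrier) → Matrix (suc n)
  addRows₀ A μ zero    s = A zero s
  addRows₀ A μ (suc i) s = A (suc i) s + μ i * A zero s

  private
    det-addRows₀-bounded : ∀ n m (A : Matrix (suc n)) (μ : Fin n → Carrier) →
      (∀ i → m ≤ toℕ i → μ i ≈ 0#) → det (suc n) (addRows₀ A μ) ≈ det (suc n) A
    det-addRows₀-bounded n zero A μ μ≈0 = det-cong (suc n) {addRows₀ A μ} {A} λ where
      zero    s → refl
      (suc i) s → trans (+-congˡ (trans (*-congʳ (μ≈0 i z≤n)) (zeroˡ _))) (+-identityʳ _)
    det-addRows₀-bounded n (suc m) A μ μ≈0 with m ℕ.<? n
    ... | no m≮n = det-addRows₀-bounded n m A μ (λ i m≤i →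
                     ⊥-elim (m≮n (ℕ.≤-<-trans m≤i (Fin.toℕ<n i))))
    ... | yes m<n = trans (det-addRow₀ n (addRows₀ A μ′) (addRows₀ A μ) i₀ (μ i₀) other-rows row-i₀)
                          (det-addRows₀-bounded n m A μ′ μ′≈0)
      where
      i₀ : Fin n
      i₀ = fromℕ< m<n
      μ′ : Fin n → Carrier
      μ′ = updateAt μ i₀ (const 0#)
      μ′≈0 : ∀ i → m ≤ toℕ i → μ′ i ≈ 0#
      μ′≈0 i m≤i with i Fin.≟ i₀
      ... | yes ≡.refl = reflexive (updateAt-updates i₀ μ)
      ... | no i≢i₀ = trans (reflexive (updateAt-minimal i i₀ μ i≢i₀)) (μ≈0 i (ℕ.≤∧≢⇒< m≤i
            (λ m≡i → i≢i₀ (Fin.toℕ-injective (≡.trans (≡.sym m≡i) (≡.sym (Fin.toℕ-fromℕ< m<n)))))))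
      other-rows : ∀ r → r ≢ suc i₀ → ∀ s → addRows₀ A μ r s ≈ addRows₀ A μ′ r s
      other-rows zero    _    s = refl
      other-rows (suc i) i≢i₀ s = +-congˡ (*-congʳ (reflexive
        (≡.sym (updateAt-minimal i i₀ μ (λ i≡i₀ → i≢i₀ (≡.cong suc i≡i₀))))))
      row-i₀ : ∀ s → addRows₀ A μ (suc i₀) s ≈ addRows₀ A μ′ (suc i₀) s + μ i₀ * A zero s
      row-i₀ s = +-congʳ (sym (trans (+-congˡ (trans (*-congʳ (reflexive (updateAt-updates i₀ μ)))
                                                    (zeroˡ _))) (+-identityʳ _)))

  det-addRows₀ : ∀ n (A : Matrix (suc n)) (μ : Fin n → Carrier) →
                 det (suc n) (addRows₀ A μ) ≈ det (suc n) A
  det-addRows₀ n A μ = det-addRows₀-bounded n n A μ (λ i n≤i → ⊥-elim (ℕ.<⇒≱ (Fin.toℕ<n i) n≤i))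

module NonzeroSearch {c ℓ} (F : Field c ℓ) (_≟_ : Decidable (Field._≈_ F)) where
  open Field F hiding (zero)

  zero-or-nonzero : ∀ n (f : Fin n → Carrier) → (∀ i → f i ≈ 0#) ⊎ ∃ λ i → ¬ (f i ≈ 0#)
  zero-or-nonzero n f with all? (λ i → f i ≟ 0#)
  ... | yes f≈0 = inj₁ f≈0
  ... | no  f≉0 = inj₂ (¬∀⟶∃¬ n _ (λ i → f i ≟ 0#) f≉0)

  zero-or-nonzero₂ : ∀ m n (f : Fin m → Fin n → Carrier) →
                     (∀ i j → f i j ≈ 0#) ⊎ ∃₂ λ i j → ¬ (f i j ≈ 0#)
  zero-or-nonzero₂ m n f with all? (λ i → all? (λ j → f i j ≟ 0#))
  ... | yes f≈0 = inj₁ f≈0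
  ... | no  f≉0 with ¬∀⟶∃¬ m _ (λ i → all? (λ j → f i j ≟ 0#)) f≉0
  ...   | i , fᵢ≉0 with zero-or-nonzero n (f i)
  ...     | inj₁ fᵢ≈0       = contradiction fᵢ≈0 fᵢ≉0
  ...     | inj₂ (j , fᵢⱼ≉0) = inj₂ (i , j , fᵢⱼ≉0)

module Multiplicativity {c ℓ} (F : Field c ℓ) (_≟_ : Decidable (Field._≈_ F)) where
  open Field F hiding (zero)
  open Matrices F
  open Determinants F
  open NonzeroSearch F _≟_
  open SetoidReasoning setoid

  Rows : ℕ → Set c
  Rows n = Fin n → Fin (suc n) → Carrier

  _·_ : ∀ {n} → Matrix n → Rows n → Rows n
  _·_ {n} M Y r s = sumF n (λ l → M r l * Y l s)

  module _ {n : ℕ} (Y : Rows n) where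
    private
      minorOf : Fin (suc n) → Carrier
      minorOf j = det n (λ r s → Y r (punchIn j s))

    det-∷-+ : ∀ (u v : Fin (suc n) → Carrier) →
              det (suc n) ((λ s → u s + v s) ∷ Y) ≈ det (suc n) (u ∷ Y) + det (suc n) (v ∷ Y)
    det-∷-+ u v = trans (altSum-cong (suc n) (λ j → distribʳ (minorOf j) (u j) (v j)))
                        (altSum-+ (suc n) (λ j → u j * minorOf j) (λ j → v j * minorOf j))

    det-∷-* : ∀ a (u : Fin (suc n) → Carrier) →
              det (suc n) ((λ s → a * u s) ∷ Y) ≈ a * det (suc n) (u ∷ Y)
    det-∷-* a u = trans (altSum-cong (suc n) (λ j → *-assoc a (u j) (minorOf j)))
                        (altSum-*ˡ (suc n) a (λ j → u j * minorOf j))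

    det-∷-sumF : ∀ m (f : Fin m → Fin (suc n) → Carrier) →
                 det (suc n) ((λ s → sumF m (λ k → f k s)) ∷ Y) ≈ sumF m (λ k → det (suc n) (f k ∷ Y))
    det-∷-sumF zero    f = altSum-zero (suc n) (λ j → 0# * minorOf j) (λ j → zeroˡ _)
    det-∷-sumF (suc m) f = trans (det-∷-+ (f zero) (λ s → sumF m (λ k → f (suc k) s)))
                                 (+-congˡ (det-∷-sumF m (λ k → f (suc k))))

  -- Only the coefficient of row 0 survives: the other rows of X occur twice.
  det-combineRow₀ : ∀ n (a : Fin (suc n) → Carrier) (X : Matrix (suc n)) →
    det (suc n) ((λ s → sumF (suc n) (λ k → a k * X k s)) ∷ tail X) ≈ a zero * det (suc n) X
  det-combineRow₀ n a X = begin
    det (suc n) ((λ s → a zero * X zero s + sumF n (λ k → other k s)) ∷ tail X)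
      ≈⟨ det-∷-+ (tail X) (λ s → a zero * X zero s) (λ s → sumF n (λ k → other k s)) ⟩
    det (suc n) ((λ s → a zero * X zero s) ∷ tail X) + det (suc n) ((λ s → sumF n (λ k → other k s)) ∷ tail X)
      ≈⟨ +-cong (det-∷-* (tail X) (a zero) (X zero)) (det-∷-sumF (tail X) n other) ⟩
    a zero * det (suc n) X + sumF n (λ k → det (suc n) (other k ∷ tail X))
      ≈⟨ +-congˡ (sumF-zero n (λ k → det (suc n) (other k ∷ tail X)) det-other≈0) ⟩
    a zero * det (suc n) X + 0#
      ≈⟨ +-identityʳ _ ⟩
    a zero * det (suc n) X ∎
    where
    other : Fin n → Fin (suc n) → Carrier
    other k s = a (suc k) * X (suc k) s
    det-other≈0 : ∀ k → det (suc n) (other k ∷ tail X) ≈ 0#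
    det-other≈0 k = trans (det-∷-* (tail X) (a (suc k)) (X (suc k)))
      (trans (*-congˡ (det-equalRows n k (X (suc k) ∷ tail X) (λ s → refl))) (zeroʳ _))

  addRowTo₀ : ∀ {n} → Matrix (suc n) → Fin n → Matrix (suc n)
  addRowTo₀ A i = (λ s → A zero s + A (suc i) s) ∷ tail A

  det-addRowTo₀ : ∀ n (A : Matrix (suc n)) i → det (suc n) (addRowTo₀ A i) ≈ det (suc n) A
  det-addRowTo₀ n A i = begin
    det (suc n) (addRowTo₀ A i)                        ≈⟨ det-∷-+ (tail A) (A zero) (A (suc i)) ⟩
    det (suc n) A + det (suc n) (A (suc i) ∷ tail A)   ≈⟨ +-congˡ (det-equalRows n i (A (suc i) ∷ tail A)
                                                                                    (λ s → refl)) ⟩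
    det (suc n) A + 0#                                 ≈⟨ +-identityʳ _ ⟩
    det (suc n) A                                      ∎

  addRowTo₀-⊗ : ∀ {n} (A X : Matrix (suc n)) i → addRowTo₀ (A ⊗ X) i ≈ᴹ (addRowTo₀ A i ⊗ X)
  addRowTo₀-⊗ {n} A X i zero    s = sym (trans
    (sumF-cong (suc n) (λ k → distribʳ (X k s) (A zero k) (A (suc i) k)))
    (sumF-+ (suc n) (λ k → A zero k * X k s) (λ k → A (suc i) k * X k s)))
  addRowTo₀-⊗ {n} A X i (suc r) s = refl

  addRows₀-⊗ : ∀ {n} (A X : Matrix (suc n)) μ → addRows₀ (A ⊗ X) μ ≈ᴹ (addRows₀ A μ ⊗ X)
  addRows₀-⊗ {n} A X μ zero    s = refl
  addRows₀-⊗ {n} A X μ (suc i) s = begin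
    sumF (suc n) (λ k → A (suc i) k * X k s) + μ i * sumF (suc n) (λ k → A zero k * X k s)
      ≈⟨ +-congˡ (sumF-*ˡ (suc n) (μ i) (λ k → A zero k * X k s)) ⟨
    sumF (suc n) (λ k → A (suc i) k * X k s) + sumF (suc n) (λ k → μ i * (A zero k * X k s))
      ≈⟨ sumF-+ (suc n) (λ k → A (suc i) k * X k s) (λ k → μ i * (A zero k * X k s)) ⟨
    sumF (suc n) (λ k → A (suc i) k * X k s + μ i * (A zero k * X k s))
      ≈⟨ sumF-cong (suc n) (λ k →
           solve 4 (λ a m b x → a :* x :+ m :* (b :* x) := (a :+ m :* b) :* x) refl
             (A (suc i) k) (μ i) (A zero k) (X k s)) ⟩
    sumF (suc n) (λ k → (A (suc i) k + μ i * A zero k) * X k s) ∎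

  ⊗-zeroColumn₀ : ∀ {n} (A X : Matrix (suc n)) → (∀ i → A (suc i) zero ≈ 0#) →
                  (A ⊗ X) ≈ᴹ ((A ⊗ X) zero ∷ (minor A zero · tail X))
  ⊗-zeroColumn₀ A X Aᵢ₀≈0 zero    s = refl
  ⊗-zeroColumn₀ A X Aᵢ₀≈0 (suc i) s =
    trans (+-congʳ (trans (*-congʳ (Aᵢ₀≈0 i)) (zeroˡ _))) (+-identityˡ _)

  module InductionStep (n : ℕ) (det-⊗ₙ : ∀ (A X : Matrix n) → det n (A ⊗ X) ≈ det n A * det n X) where

    det-∷-· : ∀ x (M : Matrix n) (Y : Rows n) → det (suc n) (x ∷ (M · Y)) ≈ det n M * det (suc n) (x ∷ Y)
    det-∷-· x M Y = trans
      (altSum-cong (suc n) (λ j → trans (*-congˡ {x j} (det-⊗ₙ M (λ l s → Y l (punchIn j s))))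
                                        (solve 3 (λ a b d → a :* (b :* d) := b :* (a :* d)) refl _ _ _)))
      (altSum-*ˡ (suc n) (det n M) (λ j → x j * det n (λ r s → Y r (punchIn j s))))

    Scales : Matrix (suc n) → Set (c ⊔ ℓ)
    Scales A = ∃ λ κ → ∀ X → det (suc n) (A ⊗ X) ≈ κ * det (suc n) X

    scales-clearedColumn : ∀ A → (∀ i → A (suc i) zero ≈ 0#) → Scales A
    scales-clearedColumn A Aᵢ₀≈0 = det n (minor A zero) * A zero zero , λ X → begin
      det (suc n) (A ⊗ X)
        ≈⟨ det-cong (suc n) (⊗-zeroColumn₀ A X Aᵢ₀≈0) ⟩
      det (suc n) ((A ⊗ X) zero ∷ (minor A zero · tail X))
        ≈⟨ det-∷-· ((A ⊗ X) zero) (minor A zero) (tail X) ⟩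
      det n (minor A zero) * det (suc n) ((A ⊗ X) zero ∷ tail X)
        ≈⟨ *-congˡ (det-combineRow₀ n (A zero) X) ⟩
      det n (minor A zero) * (A zero zero * det (suc n) X)
        ≈⟨ *-assoc _ _ _ ⟨
      (det n (minor A zero) * A zero zero) * det (suc n) X ∎

    scales-addRows₀ : ∀ A μ → Scales (addRows₀ A μ) → Scales A
    scales-addRows₀ A μ (κ , scales-by-κ) = κ , λ X → begin
      det (suc n) (A ⊗ X)                 ≈⟨ det-addRows₀ n (A ⊗ X) μ ⟨
      det (suc n) (addRows₀ (A ⊗ X) μ)    ≈⟨ det-cong (suc n) (addRows₀-⊗ A X μ) ⟩
      det (suc n) (addRows₀ A μ ⊗ X)      ≈⟨ scales-by-κ X ⟩
      κ * det (suc n) X                   ∎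

    scales-pivot : ∀ A → ¬ (A zero zero ≈ 0#) → Scales A
    scales-pivot A a≉0 with inverse (A zero zero) a≉0
    ... | a⁻¹ , aa⁻¹≈1 = scales-addRows₀ A μ (scales-clearedColumn (addRows₀ A μ) cleared)
      where
      μ : Fin n → Carrier
      μ i = - (A (suc i) zero * a⁻¹)
      cleared : ∀ i → A (suc i) zero + μ i * A zero zero ≈ 0#
      cleared i = begin
        A (suc i) zero + μ i * A zero zero
          ≈⟨ solve 3 (λ c y a → c :+ (:- (c :* y)) :* a := c :+ :- (c :* (a :* y))) refl _ _ _ ⟩
        A (suc i) zero - A (suc i) zero * (A zero zero * a⁻¹)
          ≈⟨ +-congˡ (-‿cong (trans (*-congˡ aa⁻¹≈1) (*-identityʳ _))) ⟩
        A (suc i) zero - A (suc i) zero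
          ≈⟨ -‿inverseʳ _ ⟩
        0# ∎

    scales-addRowTo₀ : ∀ A i → Scales (addRowTo₀ A i) → Scales A
    scales-addRowTo₀ A i (κ , scales-by-κ) = κ , λ X → begin
      det (suc n) (A ⊗ X)                   ≈⟨ det-addRowTo₀ n (A ⊗ X) i ⟨
      det (suc n) (addRowTo₀ (A ⊗ X) i)     ≈⟨ det-cong (suc n) (addRowTo₀-⊗ A X i) ⟩
      det (suc n) (addRowTo₀ A i ⊗ X)       ≈⟨ scales-by-κ X ⟩
      κ * det (suc n) X                     ∎

    scales : ∀ A → Scales A
    scales A with A zero zero ≟ 0#
    ... | no a≉0 = scales-pivot A a≉0
    ... | yes a≈0 with zero-or-nonzero n (λ i → A (suc i) zero)
    ...   | inj₁ cleared    = scales-clearedColumn A cleared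
    ...   | inj₂ (i , aᵢ≉0) = scales-addRowTo₀ A i (scales-pivot (addRowTo₀ A i) (λ a+aᵢ≈0 →
            aᵢ≉0 (trans (sym (trans (+-congʳ a≈0) (+-identityˡ _))) a+aᵢ≈0)))

    -- Taking X = I identifies the scale factor of A as det A.
    det-⊗ : ∀ A X → det (suc n) (A ⊗ X) ≈ det (suc n) A * det (suc n) X
    det-⊗ A X with scales A
    ... | κ , scales-by-κ = trans (scales-by-κ X) (*-congʳ (sym det-A≈κ))
      where
      det-A≈κ : det (suc n) A ≈ κ
      det-A≈κ = begin
        det (suc n) A        ≈⟨ det-cong (suc n) (⊗-identityʳ A) ⟨
        det (suc n) (A ⊗ I)  ≈⟨ scales-by-κ I ⟩
        κ * det (suc n) I    ≈⟨ *-congˡ (det-identity (suc n)) ⟩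
        κ * 1#               ≈⟨ *-identityʳ κ ⟩
        κ                    ∎

  det-⊗ : ∀ n (A X : Matrix n) → det n (A ⊗ X) ≈ det n A * det n X
  det-⊗ zero    A X = sym (*-identityˡ 1#)
  det-⊗ (suc n)     = InductionStep.det-⊗ n (det-⊗ n)

module DirectSum {c ℓ} (F : Field c ℓ) where
  open Field F hiding (zero)
  open Matrices F
  open Determinants F

  infixr 5 _⊕_
  _⊕_ : ∀ {n} → Carrier → Matrix n → Matrix (suc n)
  (a ⊕ X) zero    zero    = a
  (a ⊕ X) zero    (suc j) = 0#
  (a ⊕ X) (suc i) zero    = 0#
  (a ⊕ X) (suc i) (suc j) = X i j

  ⊕-cong : ∀ {n} {a b} {X Y : Matrix n} → a ≈ b → X ≈ᴹ Y → (a ⊕ X) ≈ᴹ (b ⊕ Y)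
  ⊕-cong a≈b X≈Y zero    zero    = a≈b
  ⊕-cong a≈b X≈Y zero    (suc j) = refl
  ⊕-cong a≈b X≈Y (suc i) zero    = refl
  ⊕-cong a≈b X≈Y (suc i) (suc j) = X≈Y i j

  ⊕-⊗ : ∀ {n} a b (X Y : Matrix n) → ((a ⊕ X) ⊗ (b ⊕ Y)) ≈ᴹ ((a * b) ⊕ (X ⊗ Y))
  ⊕-⊗ {n} a b X Y zero    zero    =
    trans (+-congˡ (sumF-zero n _ (λ k → zeroˡ _))) (+-identityʳ _)
  ⊕-⊗ {n} a b X Y zero    (suc j) =
    trans (+-cong (zeroʳ a) (sumF-zero n _ (λ k → zeroˡ _))) (+-identityʳ _)
  ⊕-⊗ {n} a b X Y (suc i) zero    =
    trans (+-cong (zeroˡ b) (sumF-zero n _ (λ k → zeroʳ _))) (+-identityʳ _)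
  ⊕-⊗ {n} a b X Y (suc i) (suc j) = trans (+-congʳ (zeroˡ 0#)) (+-identityˡ _)

  1⊕I : ∀ {n} → (1# ⊕ I {n}) ≈ᴹ I
  1⊕I zero    zero    = refl
  1⊕I zero    (suc j) = refl
  1⊕I (suc i) zero    = refl
  1⊕I (suc i) (suc j) = refl

  det-⊕ : ∀ n a (X : Matrix n) → det (suc n) (a ⊕ X) ≈ a * det n X
  det-⊕ n a X = det-firstColumn n (a ⊕ X) (λ i → refl)

module SLEquivalence {c ℓ} (F : Field c ℓ) (_≟_ : Decidable (Field._≈_ F)) where
  open Field F hiding (zero)
  open Matrices F
  open Determinants F
  open DirectSum F
  open Multiplicativity F _≟_ using (det-⊗)
  open ≈ᴹ-Reasoning

  Inverses : ∀ {n} → Matrix n → Matrix n → Set ℓ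
  Inverses P P′ = ((P ⊗ P′) ≈ᴹ I) × ((P′ ⊗ P) ≈ᴹ I)

  -- SLEquiv with the inverses of P and Q recorded: since the normal form of a
  -- matrix of determinant 1 is I, this is how such matrices are shown invertible.
  record _∼_ {n} (A B : Matrix n) : Set (c ⊔ ℓ) where
    field
      P P⁻¹ Q Q⁻¹ : Matrix n
      P-SL        : IsSL P
      Q-SL        : IsSL Q
      P-inverses  : Inverses P P⁻¹
      Q-inverses  : Inverses Q Q⁻¹
      A≈PBQ       : A ≈ᴹ ((P ⊗ B) ⊗ Q)

  ∼⇒SLEquiv : ∀ {n} {A B : Matrix n} → A ∼ B → SLEquiv A B
  ∼⇒SLEquiv A∼B = P , Q , P-SL , Q-SL , A≈PBQ
    where open _∼_ A∼B

  ⊗-sandwich : ∀ {n} (X Y Y′ Z : Matrix n) → (Y ⊗ Y′) ≈ᴹ I → ((X ⊗ Y) ⊗ (Y′ ⊗ Z)) ≈ᴹ (X ⊗ Z)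
  ⊗-sandwich X Y Y′ Z YY′≈I = begin
    (X ⊗ Y) ⊗ (Y′ ⊗ Z)   ≈⟨ ⊗-assoc X Y (Y′ ⊗ Z) ⟩
    X ⊗ (Y ⊗ (Y′ ⊗ Z))   ≈⟨ ⊗-congˡ (⊗-assoc Y Y′ Z) ⟨
    X ⊗ ((Y ⊗ Y′) ⊗ Z)   ≈⟨ ⊗-congˡ (⊗-congʳ YY′≈I) ⟩
    X ⊗ (I ⊗ Z)          ≈⟨ ⊗-congˡ (⊗-identityˡ Z) ⟩
    X ⊗ Z                ∎

  Inverses-I : ∀ {n} → Inverses {n} I I
  Inverses-I = ⊗-identityˡ I , ⊗-identityˡ I

  Inverses-⊗ : ∀ {n} {P P′ R R′ : Matrix n} → Inverses P P′ → Inverses R R′ →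
               Inverses (P ⊗ R) (R′ ⊗ P′)
  Inverses-⊗ {P = P} {P′} {R} {R′} (PP′≈I , P′P≈I) (RR′≈I , R′R≈I) =
    ≈ᴹ-trans (⊗-sandwich P R R′ P′ RR′≈I) PP′≈I ,
    ≈ᴹ-trans (⊗-sandwich R′ P′ P R P′P≈I) R′R≈I

  Inverses-⊕ : ∀ {n} {P P′ : Matrix n} → Inverses P P′ → Inverses (1# ⊕ P) (1# ⊕ P′)
  Inverses-⊕ {P = P} {P′} (PP′≈I , P′P≈I) =
    ≈ᴹ-trans (⊕-⊗ 1# 1# P P′) (≈ᴹ-trans (⊕-cong (*-identityˡ 1#) PP′≈I) 1⊕I) ,
    ≈ᴹ-trans (⊕-⊗ 1# 1# P′ P) (≈ᴹ-trans (⊕-cong (*-identityˡ 1#) P′P≈I) 1⊕I)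

  IsSL-I : ∀ {n} → IsSL {n} I
  IsSL-I {n} = det-identity n

  IsSL-⊗ : ∀ {n} {P R : Matrix n} → IsSL P → IsSL R → IsSL (P ⊗ R)
  IsSL-⊗ {n} {P} {R} P-SL R-SL = trans (det-⊗ n P R) (trans (*-cong P-SL R-SL) (*-identityˡ 1#))

  IsSL-⊕ : ∀ {n} {P : Matrix n} → IsSL P → IsSL (1# ⊕ P)
  IsSL-⊕ {n} {P} P-SL = trans (det-⊕ n 1# P) (trans (*-identityˡ _) P-SL)

  Inverses-respˡ : ∀ {n} {P P′ R : Matrix n} → P ≈ᴹ P′ → Inverses P R → Inverses P′ R
  Inverses-respˡ P≈P′ (PR≈I , RP≈I) =
    ≈ᴹ-trans (⊗-congʳ (≈ᴹ-sym P≈P′)) PR≈I , ≈ᴹ-trans (⊗-congˡ (≈ᴹ-sym P≈P′)) RP≈I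

  cancel-PBQ : ∀ {n} {P P⁻¹ Q Q⁻¹ A B : Matrix n} → (P⁻¹ ⊗ P) ≈ᴹ I → (Q ⊗ Q⁻¹) ≈ᴹ I →
               A ≈ᴹ ((P ⊗ B) ⊗ Q) → B ≈ᴹ ((P⁻¹ ⊗ A) ⊗ Q⁻¹)
  cancel-PBQ {P = P} {P⁻¹} {Q} {Q⁻¹} {A} {B} P⁻¹P≈I QQ⁻¹≈I A≈PBQ = begin
    B                                   ≈⟨ ⊗-identityˡ B ⟨
    I ⊗ B                               ≈⟨ ⊗-congʳ P⁻¹P≈I ⟨
    (P⁻¹ ⊗ P) ⊗ B                       ≈⟨ ⊗-assoc P⁻¹ P B ⟩
    P⁻¹ ⊗ (P ⊗ B)                       ≈⟨ ⊗-identityʳ _ ⟨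
    (P⁻¹ ⊗ (P ⊗ B)) ⊗ I                 ≈⟨ ⊗-congˡ QQ⁻¹≈I ⟨
    (P⁻¹ ⊗ (P ⊗ B)) ⊗ (Q ⊗ Q⁻¹)         ≈⟨ ⊗-assoc (P⁻¹ ⊗ (P ⊗ B)) Q Q⁻¹ ⟨
    ((P⁻¹ ⊗ (P ⊗ B)) ⊗ Q) ⊗ Q⁻¹         ≈⟨ ⊗-congʳ (⊗-assoc P⁻¹ (P ⊗ B) Q) ⟩
    (P⁻¹ ⊗ ((P ⊗ B) ⊗ Q)) ⊗ Q⁻¹         ≈⟨ ⊗-congʳ (⊗-congˡ A≈PBQ) ⟨
    (P⁻¹ ⊗ A) ⊗ Q⁻¹                     ∎

  ∼-reflexive : ∀ {n} {A B : Matrix n} → A ≈ᴹ B → A ∼ B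
  ∼-reflexive {n} {B = B} A≈B = record
    { P = I ; P⁻¹ = I ; Q = I ; Q⁻¹ = I ; P-SL = IsSL-I {n} ; Q-SL = IsSL-I {n}
    ; P-inverses = Inverses-I ; Q-inverses = Inverses-I
    ; A≈PBQ = ≈ᴹ-trans A≈B (≈ᴹ-sym (≈ᴹ-trans (⊗-identityʳ (I ⊗ B)) (⊗-identityˡ B)))
    }

  ∼-trans : ∀ {n} {A B C : Matrix n} → A ∼ B → B ∼ C → A ∼ C
  ∼-trans {n} {A} {B} {C} A∼B B∼C = record
    { P = P₁ ⊗ P₂ ; P⁻¹ = P₂⁻¹ ⊗ P₁⁻¹ ; Q = Q₂ ⊗ Q₁ ; Q⁻¹ = Q₁⁻¹ ⊗ Q₂⁻¹
    ; P-SL = IsSL-⊗ {n} {P₁} {P₂} P₁-SL P₂-SL ; Q-SL = IsSL-⊗ {n} {Q₂} {Q₁} Q₂-SL Q₁-SL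
    ; P-inverses = Inverses-⊗ P₁-inverses P₂-inverses
    ; Q-inverses = Inverses-⊗ Q₂-inverses Q₁-inverses
    ; A≈PBQ = begin
        A                                  ≈⟨ A≈P₁BQ₁ ⟩
        (P₁ ⊗ B) ⊗ Q₁                      ≈⟨ ⊗-congʳ (⊗-congˡ B≈P₂CQ₂) ⟩
        (P₁ ⊗ ((P₂ ⊗ C) ⊗ Q₂)) ⊗ Q₁        ≈⟨ ⊗-congʳ (⊗-assoc P₁ (P₂ ⊗ C) Q₂) ⟨
        ((P₁ ⊗ (P₂ ⊗ C)) ⊗ Q₂) ⊗ Q₁        ≈⟨ ⊗-congʳ (⊗-congʳ (⊗-assoc P₁ P₂ C)) ⟨
        (((P₁ ⊗ P₂) ⊗ C) ⊗ Q₂) ⊗ Q₁        ≈⟨ ⊗-assoc ((P₁ ⊗ P₂) ⊗ C) Q₂ Q₁ ⟩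
        ((P₁ ⊗ P₂) ⊗ C) ⊗ (Q₂ ⊗ Q₁)        ∎
    }
    where
    open _∼_ A∼B renaming (P to P₁; P⁻¹ to P₁⁻¹; Q to Q₁; Q⁻¹ to Q₁⁻¹; P-SL to P₁-SL; Q-SL to Q₁-SL;
                           P-inverses to P₁-inverses; Q-inverses to Q₁-inverses; A≈PBQ to A≈P₁BQ₁)
    open _∼_ B∼C renaming (P to P₂; P⁻¹ to P₂⁻¹; Q to Q₂; Q⁻¹ to Q₂⁻¹; P-SL to P₂-SL; Q-SL to Q₂-SL;
                           P-inverses to P₂-inverses; Q-inverses to Q₂-inverses; A≈PBQ to B≈P₂CQ₂)

  ∼-⊗ˡ : ∀ {n} (A : Matrix n) {E E′ : Matrix n} → IsSL E → Inverses E E′ → A ∼ (E′ ⊗ A)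
  ∼-⊗ˡ {n} A {E} {E′} E-SL E-inverses = record
    { P = E ; P⁻¹ = E′ ; Q = I ; Q⁻¹ = I ; P-SL = E-SL ; Q-SL = IsSL-I {n}
    ; P-inverses = E-inverses ; Q-inverses = Inverses-I
    ; A≈PBQ = begin
        A                  ≈⟨ ⊗-identityˡ A ⟨
        I ⊗ A              ≈⟨ ⊗-congʳ (proj₁ E-inverses) ⟨
        (E ⊗ E′) ⊗ A       ≈⟨ ⊗-assoc E E′ A ⟩
        E ⊗ (E′ ⊗ A)       ≈⟨ ⊗-identityʳ (E ⊗ (E′ ⊗ A)) ⟨
        (E ⊗ (E′ ⊗ A)) ⊗ I ∎
    }

  ∼-⊗ʳ : ∀ {n} (A : Matrix n) {E E′ : Matrix n} → IsSL E → Inverses E E′ → A ∼ (A ⊗ E′)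
  ∼-⊗ʳ {n} A {E} {E′} E-SL E-inverses = record
    { P = I ; P⁻¹ = I ; Q = E ; Q⁻¹ = E′ ; P-SL = IsSL-I {n} ; Q-SL = E-SL
    ; P-inverses = Inverses-I ; Q-inverses = E-inverses
    ; A≈PBQ = begin
        A                  ≈⟨ ⊗-identityʳ A ⟨
        A ⊗ I              ≈⟨ ⊗-congˡ (proj₂ E-inverses) ⟨
        A ⊗ (E′ ⊗ E)       ≈⟨ ⊗-assoc A E′ E ⟨
        (A ⊗ E′) ⊗ E       ≈⟨ ⊗-congʳ (⊗-identityˡ (A ⊗ E′)) ⟨
        (I ⊗ (A ⊗ E′)) ⊗ E ∎
    }

  ⊕I-⊗ : ∀ {n} a b → ((a ⊕ I) ⊗ (b ⊕ I)) ≈ᴹ ((a * b) ⊕ I {n})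
  ⊕I-⊗ a b = ≈ᴹ-trans (⊕-⊗ a b I I) (⊕-cong refl (⊗-identityˡ I))

  ⊕I≈I : ∀ {n} {a} → a ≈ 1# → (a ⊕ I {n}) ≈ᴹ I
  ⊕I≈I a≈1 = ≈ᴹ-trans (⊕-cong a≈1 ≈ᴹ-refl) 1⊕I

  ∼-rescale : ∀ {n} {p p⁻¹} → p * p⁻¹ ≈ 1# → (A : Matrix (suc n)) → (p ⊕ A) ∼ (1# ⊕ ((p ⊕ I) ⊗ A))
  ∼-rescale {n} {p} {p⁻¹} pp⁻¹≈1 A = record
    { P = p ⊕ (p⁻¹ ⊕ I) ; P⁻¹ = p⁻¹ ⊕ (p ⊕ I) ; Q = I ; Q⁻¹ = I
    ; P-SL = trans (det-⊕ (suc n) p (p⁻¹ ⊕ I))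
               (trans (*-congˡ (trans (det-⊕ n p⁻¹ I) (trans (*-congˡ (det-identity n)) (*-identityʳ p⁻¹))))
                      pp⁻¹≈1)
    ; Q-SL = IsSL-I {suc (suc n)}
    ; P-inverses = diagonal-inverse pp⁻¹≈1 p⁻¹p≈1 , diagonal-inverse p⁻¹p≈1 pp⁻¹≈1
    ; Q-inverses = Inverses-I
    ; A≈PBQ = begin
        p ⊕ A                                               ≈⟨ ⊕-cong (*-identityʳ p) (⊗-identityˡ A) ⟨
        (p * 1#) ⊕ (I ⊗ A)                                  ≈⟨ ⊕-cong refl (⊗-congʳ {B = A} (⊕I≈I p⁻¹p≈1)) ⟨
        (p * 1#) ⊕ (((p⁻¹ * p) ⊕ I) ⊗ A)                    ≈⟨ ⊕-cong refl (⊗-congʳ {B = A} (⊕I-⊗ p⁻¹ p)) ⟨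
        (p * 1#) ⊕ (((p⁻¹ ⊕ I) ⊗ (p ⊕ I)) ⊗ A)              ≈⟨ ⊕-cong refl (⊗-assoc (p⁻¹ ⊕ I) (p ⊕ I) A) ⟩
        (p * 1#) ⊕ ((p⁻¹ ⊕ I) ⊗ ((p ⊕ I) ⊗ A))              ≈⟨ ⊕-⊗ p 1# (p⁻¹ ⊕ I) ((p ⊕ I) ⊗ A) ⟨
        (p ⊕ (p⁻¹ ⊕ I)) ⊗ (1# ⊕ ((p ⊕ I) ⊗ A))              ≈⟨ ⊗-identityʳ _ ⟨
        ((p ⊕ (p⁻¹ ⊕ I)) ⊗ (1# ⊕ ((p ⊕ I) ⊗ A))) ⊗ I        ∎
    }
    where
    p⁻¹p≈1 : p⁻¹ * p ≈ 1#
    p⁻¹p≈1 = trans (*-comm p⁻¹ p) pp⁻¹≈1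
    diagonal-inverse : ∀ {a b} → a * b ≈ 1# → b * a ≈ 1# → ((a ⊕ (b ⊕ I)) ⊗ (b ⊕ (a ⊕ I))) ≈ᴹ I
    diagonal-inverse {a} {b} ab≈1 ba≈1 = begin
      (a ⊕ (b ⊕ I)) ⊗ (b ⊕ (a ⊕ I))   ≈⟨ ⊕-⊗ a b (b ⊕ I) (a ⊕ I) ⟩
      (a * b) ⊕ ((b ⊕ I) ⊗ (a ⊕ I))   ≈⟨ ⊕-cong ab≈1 (⊕I-⊗ b a) ⟩
      1# ⊕ ((b * a) ⊕ I)              ≈⟨ ⊕-cong refl (⊕I≈I ba≈1) ⟩
      1# ⊕ I                          ≈⟨ 1⊕I ⟩
      I                               ∎

  ∼-⊕ : ∀ {n} {A B : Matrix n} → A ∼ B → (1# ⊕ A) ∼ (1# ⊕ B)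
  ∼-⊕ {n} {A} {B} A∼B = record
    { P = 1# ⊕ P ; P⁻¹ = 1# ⊕ P⁻¹ ; Q = 1# ⊕ Q ; Q⁻¹ = 1# ⊕ Q⁻¹
    ; P-SL = IsSL-⊕ {n} {P} P-SL ; Q-SL = IsSL-⊕ {n} {Q} Q-SL
    ; P-inverses = Inverses-⊕ P-inverses ; Q-inverses = Inverses-⊕ Q-inverses
    ; A≈PBQ = begin
        1# ⊕ A                           ≈⟨ ⊕-cong (sym (*-identityˡ 1#)) A≈PBQ ⟩
        (1# * 1#) ⊕ ((P ⊗ B) ⊗ Q)        ≈⟨ ⊕-cong (sym (*-identityʳ (1# * 1#))) ≈ᴹ-refl ⟩
        ((1# * 1#) * 1#) ⊕ ((P ⊗ B) ⊗ Q) ≈⟨ ⊕-⊗ (1# * 1#) 1# (P ⊗ B) Q ⟨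
        ((1# * 1#) ⊕ (P ⊗ B)) ⊗ (1# ⊕ Q) ≈⟨ ⊗-congʳ {B = 1# ⊕ Q} (⊕-⊗ 1# 1# P B) ⟨
        ((1# ⊕ P) ⊗ (1# ⊕ B)) ⊗ (1# ⊕ Q) ∎
    }
    where open _∼_ A∼B

module NormalForm {c ℓ} (F : Field c ℓ) (_≟_ : Decidable (Field._≈_ F)) where
  open Field F hiding (zero)
  open Matrices F
  open Determinants F
  open DirectSum F
  open SLEquivalence F _≟_
  open NonzeroSearch F _≟_
  open SetoidReasoning setoid

  upper : ∀ {n} → (Fin n → Carrier) → Matrix (suc n)
  upper w zero    zero    = 1#
  upper w zero    (suc j) = w j
  upper w (suc i) zero    = 0#
  upper w (suc i) (suc j) = δ i j

  lower : ∀ {n} → (Fin n → Carrier) → Matrix (suc n)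
  lower v zero    zero    = 1#
  lower v zero    (suc j) = 0#
  lower v (suc i) zero    = v i
  lower v (suc i) (suc j) = δ i j

  module _ {n : ℕ} where
    upper-⊗₀ : ∀ (w : Fin n → Carrier) (X : Matrix (suc n)) s →
               (upper w ⊗ X) zero s ≈ X zero s + sumF n (λ k → w k * X (suc k) s)
    upper-⊗₀ w X s = +-congʳ (*-identityˡ _)

    upper-⊗ₛ : ∀ (w : Fin n → Carrier) (X : Matrix (suc n)) i s → (upper w ⊗ X) (suc i) s ≈ X (suc i) s
    upper-⊗ₛ w X i s = trans (+-cong (zeroˡ _) (sumF-δˡ n i (λ k → X (suc k) s))) (+-identityˡ _)

    lower-⊗₀ : ∀ (v : Fin n → Carrier) (X : Matrix (suc n)) s → (lower v ⊗ X) zero s ≈ X zero s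
    lower-⊗₀ v X s = trans (+-cong (*-identityˡ _) (sumF-zero n _ (λ k → zeroˡ _))) (+-identityʳ _)

    lower-⊗ₛ : ∀ (v : Fin n → Carrier) (X : Matrix (suc n)) i s →
               (lower v ⊗ X) (suc i) s ≈ X (suc i) s + v i * X zero s
    lower-⊗ₛ v X i s = trans (+-congˡ (sumF-δˡ n i (λ k → X (suc k) s))) (+-comm _ _)

    ⊗-upper₀ : ∀ (w : Fin n → Carrier) (X : Matrix (suc n)) r → (X ⊗ upper w) r zero ≈ X r zero
    ⊗-upper₀ w X r = trans (+-cong (*-identityʳ _) (sumF-zero n _ (λ k → zeroʳ _))) (+-identityʳ _)

    ⊗-upperₛ : ∀ (w : Fin n → Carrier) (X : Matrix (suc n)) r j →
               (X ⊗ upper w) r (suc j) ≈ X r (suc j) + X r zero * w j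
    ⊗-upperₛ w X r j = trans (+-congˡ (sumF-δʳ n j (λ k → X r (suc k)))) (+-comm _ _)

    ⊗-lower₀ : ∀ (v : Fin n → Carrier) (X : Matrix (suc n)) r →
               (X ⊗ lower v) r zero ≈ X r zero + sumF n (λ k → X r (suc k) * v k)
    ⊗-lower₀ v X r = +-congʳ (*-identityʳ _)

    upper-inverse : ∀ (w w′ : Fin n → Carrier) → (∀ k → w k + w′ k ≈ 0#) → (upper w′ ⊗ upper w) ≈ᴹ I
    upper-inverse w w′ w+w′≈0 zero    zero    = trans (upper-⊗₀ w′ (upper w) zero)
      (trans (+-congˡ (sumF-zero n _ (λ k → zeroʳ _))) (+-identityʳ _))
    upper-inverse w w′ w+w′≈0 zero    (suc j) = trans (upper-⊗₀ w′ (upper w) (suc j))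
      (trans (+-congˡ (sumF-δʳ n j w′)) (w+w′≈0 j))
    upper-inverse w w′ w+w′≈0 (suc i) zero    = upper-⊗ₛ w′ (upper w) i zero
    upper-inverse w w′ w+w′≈0 (suc i) (suc j) = upper-⊗ₛ w′ (upper w) i (suc j)

    lower-inverse : ∀ (v v′ : Fin n → Carrier) → (∀ k → v k + v′ k ≈ 0#) → (lower v ⊗ lower v′) ≈ᴹ I
    lower-inverse v v′ v+v′≈0 zero    zero    = lower-⊗₀ v (lower v′) zero
    lower-inverse v v′ v+v′≈0 zero    (suc j) = lower-⊗₀ v (lower v′) (suc j)
    lower-inverse v v′ v+v′≈0 (suc i) zero    = trans (lower-⊗ₛ v (lower v′) i zero)
      (trans (+-congˡ (*-identityʳ _)) (trans (+-comm _ _) (v+v′≈0 i)))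
    lower-inverse v v′ v+v′≈0 (suc i) (suc j) = trans (lower-⊗ₛ v (lower v′) i (suc j))
      (trans (+-congˡ (zeroʳ _)) (+-identityʳ _))

    upper-inverses : ∀ (w : Fin n → Carrier) → Inverses (upper (λ k → - w k)) (upper w)
    upper-inverses w = upper-inverse w _ (λ k → -‿inverseʳ _) , upper-inverse _ w (λ k → -‿inverseˡ _)

    lower-inverses : ∀ (v : Fin n → Carrier) → Inverses (lower (λ k → - v k)) (lower v)
    lower-inverses v = lower-inverse _ v (λ k → -‿inverseˡ _) , lower-inverse v _ (λ k → -‿inverseʳ _)

    upper-SL : ∀ (w : Fin n → Carrier) → IsSL (upper w)
    upper-SL w = trans (det-firstColumn n (upper w) (λ i → refl)) (trans (*-identityˡ _) (det-identity n))

    lower-SL : ∀ (v : Fin n → Carrier) → IsSL (lower v)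
    lower-SL v = trans (det-firstRow n (lower v) (λ j → refl)) (trans (*-identityˡ _) (det-identity n))

    ∼-upper : ∀ (A : Matrix (suc n)) (w : Fin n → Carrier) → A ∼ (upper w ⊗ A)
    ∼-upper A w = ∼-⊗ˡ A {upper (λ k → - w k)} {upper w} (upper-SL (λ k → - w k)) (upper-inverses w)

    ∼-lower : ∀ (A : Matrix (suc n)) (v : Fin n → Carrier) → A ∼ (lower v ⊗ A)
    ∼-lower A v = ∼-⊗ˡ A {lower (λ k → - v k)} {lower v} (lower-SL (λ k → - v k)) (lower-inverses v)

    ∼-⊗upper : ∀ (A : Matrix (suc n)) (w : Fin n → Carrier) → A ∼ (A ⊗ upper w)
    ∼-⊗upper A w = ∼-⊗ʳ A {upper (λ k → - w k)} {upper w} (upper-SL (λ k → - w k)) (upper-inverses w)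

    ∼-⊗lower : ∀ (A : Matrix (suc n)) (v : Fin n → Carrier) → A ∼ (A ⊗ lower v)
    ∼-⊗lower A v = ∼-⊗ʳ A {lower (λ k → - v k)} {lower v} (lower-SL (λ k → - v k)) (lower-inverses v)

    upper-δ-⊗₀ : ∀ i (X : Matrix (suc n)) s → (upper (δ i) ⊗ X) zero s ≈ X zero s + X (suc i) s
    upper-δ-⊗₀ i X s = trans (upper-⊗₀ (δ i) X s) (+-congˡ (sumF-δˡ n i (λ k → X (suc k) s)))

    ⊗-lower-δ₀ : ∀ j (X : Matrix (suc n)) r → (X ⊗ lower (λ k → δ k j)) r zero ≈ X r zero + X r (suc j)
    ⊗-lower-δ₀ j X r = trans (⊗-lower₀ (λ k → δ k j) X r) (+-congˡ (sumF-δʳ n j (λ k → X r (suc k))))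

  pivot : ∀ {n} (A : Matrix (suc n)) →
          (∀ i j → A i j ≈ 0#) ⊎ ∃ λ A′ → A ∼ A′ × ¬ (A′ zero zero ≈ 0#)
  pivot {n} A with A zero zero ≟ 0#
  ... | no a≉0 = inj₂ (A , ∼-reflexive ≈ᴹ-refl , a≉0)
  ... | yes a≈0 with zero-or-nonzero n (λ i → A (suc i) zero)
  ...   | inj₂ (i , aᵢ≉0) = inj₂ (upper (δ i) ⊗ A , ∼-upper A (δ i) , λ e → aᵢ≉0 (begin
          A (suc i) zero                  ≈⟨ +-identityˡ _ ⟨
          0# + A (suc i) zero             ≈⟨ +-congʳ a≈0 ⟨
          A zero zero + A (suc i) zero    ≈⟨ upper-δ-⊗₀ i A zero ⟨
          (upper (δ i) ⊗ A) zero zero     ≈⟨ e ⟩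
          0#                              ∎))
  ...   | inj₁ column≈0 with zero-or-nonzero n (λ j → A zero (suc j))
  ...     | inj₂ (j , aⱼ≉0) = inj₂ (A ⊗ lower (λ k → δ k j) , ∼-⊗lower A (λ k → δ k j) , λ e → aⱼ≉0 (begin
            A zero (suc j)                        ≈⟨ +-identityˡ _ ⟨
            0# + A zero (suc j)                   ≈⟨ +-congʳ a≈0 ⟨
            A zero zero + A zero (suc j)          ≈⟨ ⊗-lower-δ₀ j A zero ⟨
            (A ⊗ lower (λ k → δ k j)) zero zero   ≈⟨ e ⟩
            0#                                    ∎))
  ...     | inj₁ row≈0 with zero-or-nonzero₂ n n (λ i j → A (suc i) (suc j))
  ...       | inj₁ rest≈0 = inj₁ λ where
              zero    zero    → a≈0
              zero    (suc j) → row≈0 j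
              (suc i) zero    → column≈0 i
              (suc i) (suc j) → rest≈0 i j
  ...       | inj₂ (i , j , aᵢⱼ≉0) =
              inj₂ (B ⊗ lower (λ k → δ k j) , ∼-trans (∼-upper A (δ i)) (∼-⊗lower B (λ k → δ k j)) ,
                    λ e → aᵢⱼ≉0 (begin
                      A (suc i) (suc j)
                        ≈⟨ solve 1 (λ x → x := (con (+ 0) :+ con (+ 0)) :+ (con (+ 0) :+ x)) refl _ ⟩
                      (0# + 0#) + (0# + A (suc i) (suc j))
                        ≈⟨ +-cong (+-cong a≈0 (column≈0 i)) (+-congʳ (row≈0 j)) ⟨
                      (A zero zero + A (suc i) zero) + (A zero (suc j) + A (suc i) (suc j))
                        ≈⟨ +-cong (upper-δ-⊗₀ i A zero) (upper-δ-⊗₀ i A (suc j)) ⟨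
                      B zero zero + B zero (suc j)
                        ≈⟨ ⊗-lower-δ₀ j B zero ⟨
                      (B ⊗ lower (λ k → δ k j)) zero zero
                        ≈⟨ e ⟩
                      0# ∎))
      where
      B : Matrix (suc n)
      B = upper (δ i) ⊗ A

  ∼-clearPivot : ∀ {m} (A : Matrix (suc (suc m))) {p⁻¹} → A zero zero * p⁻¹ ≈ 1# →
                 ∃ λ A′ → A ∼ (A zero zero ⊕ A′)
  ∼-clearPivot {m} A {p⁻¹} pp⁻¹≈1 =
    minor A₃ zero , ∼-trans (∼-trans (∼-lower A v) (∼-⊗upper A₂ w)) (∼-reflexive A₃≈p⊕A′)
    where
    p : Carrier
    p = A zero zero
    v : Fin (suc m) → Carrier
    v i = - (A (suc i) zero * p⁻¹)
    A₂ : Matrix (suc (suc m))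
    A₂ = lower v ⊗ A
    w : Fin (suc m) → Carrier
    w j = - (p⁻¹ * A₂ zero (suc j))
    A₃ : Matrix (suc (suc m))
    A₃ = A₂ ⊗ upper w
    A₂₀₀≈p : A₂ zero zero ≈ p
    A₂₀₀≈p = lower-⊗₀ v A zero
    A₃≈p⊕A′ : A₃ ≈ᴹ (p ⊕ minor A₃ zero)
    A₃≈p⊕A′ zero zero = trans (⊗-upper₀ w A₂ zero) A₂₀₀≈p
    A₃≈p⊕A′ zero (suc j) = begin
      A₃ zero (suc j)                                   ≈⟨ ⊗-upperₛ w A₂ zero j ⟩
      A₂ zero (suc j) + A₂ zero zero * w j              ≈⟨ +-congˡ (*-congʳ A₂₀₀≈p) ⟩
      A₂ zero (suc j) + p * - (p⁻¹ * A₂ zero (suc j))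
        ≈⟨ solve 3 (λ x a b → x :+ a :* (:- (b :* x)) := x :+ :- ((a :* b) :* x)) refl _ _ _ ⟩
      A₂ zero (suc j) - (p * p⁻¹) * A₂ zero (suc j)
        ≈⟨ +-congˡ (-‿cong (trans (*-congʳ pp⁻¹≈1) (*-identityˡ _))) ⟩
      A₂ zero (suc j) - A₂ zero (suc j)                 ≈⟨ -‿inverseʳ _ ⟩
      0#                                                ∎
    A₃≈p⊕A′ (suc i) zero = begin
      A₃ (suc i) zero                                   ≈⟨ ⊗-upper₀ w A₂ (suc i) ⟩
      A₂ (suc i) zero                                   ≈⟨ lower-⊗ₛ v A i zero ⟩
      A (suc i) zero + - (A (suc i) zero * p⁻¹) * p
        ≈⟨ solve 3 (λ x b a → x :+ (:- (x :* b)) :* a := x :+ :- (x :* (a :* b))) refl _ _ _ ⟩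
      A (suc i) zero - A (suc i) zero * (p * p⁻¹)
        ≈⟨ +-congˡ (-‿cong (trans (*-congˡ pp⁻¹≈1) (*-identityʳ _))) ⟩
      A (suc i) zero - A (suc i) zero                   ≈⟨ -‿inverseʳ _ ⟩
      0#                                                ∎
    A₃≈p⊕A′ (suc i) (suc j) = refl

  reduce : ∀ {m} (A : Matrix (suc (suc m))) → ¬ (A zero zero ≈ 0#) → ∃ λ A′ → A ∼ (1# ⊕ A′)
  reduce A a≉0 with inverse (A zero zero) a≉0
  ... | p⁻¹ , pp⁻¹≈1 with ∼-clearPivot A pp⁻¹≈1
  ...   | A′ , A∼p⊕A′ = (A zero zero ⊕ I) ⊗ A′ , ∼-trans A∼p⊕A′ (∼-rescale pp⁻¹≈1 A′)

  E : ∀ {n} → ℕ → Matrix n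
  E {zero}  r       = λ ()
  E {suc n} zero    = λ _ _ → 0#
  E {suc n} (suc r) = 1# ⊕ E r

  D : ∀ {n} → Carrier → Matrix (suc n)
  D {zero}  d = λ _ _ → d
  D {suc n} d = 1# ⊕ D d

  NormalForm : ∀ m → Matrix (suc m) → Set (c ⊔ ℓ)
  NormalForm m A = (∃ λ r → r < suc m × A ∼ E r) ⊎ (∃ λ d → ¬ (d ≈ 0#) × A ∼ D d)

  normalForm : ∀ m (A : Matrix (suc m)) → NormalForm m A
  normalForm zero A with A zero zero ≟ 0#
  ... | yes a≈0 = inj₁ (0 , s≤s z≤n , ∼-reflexive (λ { zero zero → a≈0 }))
  ... | no  a≉0 = inj₂ (A zero zero , a≉0 , ∼-reflexive (λ { zero zero → refl }))
  normalForm (suc m) A with pivot A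
  ... | inj₁ A≈0 = inj₁ (0 , s≤s z≤n , ∼-reflexive A≈0)
  ... | inj₂ (A₁ , A∼A₁ , a≉0) with reduce A₁ a≉0
  ...   | A₂ , A₁∼1⊕A₂ with normalForm m A₂
  ...     | inj₁ (r , r≤m , A₂∼E) = inj₁ (suc r , s≤s r≤m , ∼-trans A∼A₁ (∼-trans A₁∼1⊕A₂ (∼-⊕ A₂∼E)))
  ...     | inj₂ (d , d≉0 , A₂∼D) = inj₂ (d , d≉0 , ∼-trans A∼A₁ (∼-trans A₁∼1⊕A₂ (∼-⊕ A₂∼D)))

module Separation {c ℓ} (F : Field c ℓ) (_≟_ : Decidable (Field._≈_ F)) where
  open Field F hiding (zero)
  open Matrices F
  open Determinants F
  open Multiplicativity F _≟_ using (det-⊗)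
  open DirectSum F
  open SLEquivalence F _≟_
  open NormalForm F _≟_
  open SetoidReasoning setoid

  det-SLEquiv : ∀ {n} {A B : Matrix n} → SLEquiv A B → det n A ≈ det n B
  det-SLEquiv {n} {A} {B} (P , Q , P-SL , Q-SL , A≈PBQ) = begin
    det n A                   ≈⟨ det-cong n A≈PBQ ⟩
    det n ((P ⊗ B) ⊗ Q)       ≈⟨ det-⊗ n (P ⊗ B) Q ⟩
    det n (P ⊗ B) * det n Q   ≈⟨ *-cong (det-⊗ n P B) Q-SL ⟩
    (det n P * det n B) * 1#  ≈⟨ *-identityʳ _ ⟩
    det n P * det n B         ≈⟨ *-congʳ P-SL ⟩
    1# * det n B              ≈⟨ *-identityˡ _ ⟩
    det n B                   ∎

  det-E : ∀ {n} r → r < n → det n (E {n} r) ≈ 0#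
  det-E {suc n} zero    _         = det-zeroRow (suc n) (E zero) zero (λ _ → refl)
  det-E {suc n} (suc r) (s≤s r<n) = trans (det-⊕ n 1# (E r)) (trans (*-identityˡ _) (det-E r r<n))

  det-D : ∀ {n} d → det (suc n) (D {n} d) ≈ d
  det-D {zero}  d = trans (+-cong (*-identityʳ d) -0#≈0#) (+-identityʳ d)
  det-D {suc n} d = trans (det-⊕ (suc n) 1# (D d)) (trans (*-identityˡ _) (det-D {n} d))

  D-cong : ∀ {n} {d d′} → d ≈ d′ → D {n} d ≈ᴹ D d′
  D-cong {zero}  d≈d′ zero zero = d≈d′
  D-cong {suc n} d≈d′ = ⊕-cong refl (D-cong d≈d′)

  D≈I : ∀ {n} {d} → d ≈ 1# → D {n} d ≈ᴹ I
  D≈I {zero}  d≈1 zero zero = d≈1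
  D≈I {suc n} d≈1 = ≈ᴹ-trans (⊕-cong refl (D≈I d≈1)) 1⊕I

  SL-invertible : ∀ m (P : Matrix (suc m)) → IsSL P → ∃ λ P⁻¹ → Inverses P P⁻¹
  SL-invertible m P P-SL with normalForm m P
  ... | inj₁ (r , r≤m , P∼E) = ⊥-elim (0≉1 (begin
        0#                  ≈⟨ det-E r r≤m ⟨
        det (suc m) (E r)   ≈⟨ det-SLEquiv {A = P} {E r} (∼⇒SLEquiv P∼E) ⟨
        det (suc m) P       ≈⟨ P-SL ⟩
        1#                  ∎))
  ... | inj₂ (d , _ , P∼D) = R⁻¹ ⊗ L⁻¹ , Inverses-respˡ {P = L ⊗ R} {P} {R⁻¹ ⊗ L⁻¹} LR≈P
                               (Inverses-⊗ {P = L} {L⁻¹} {R} {R⁻¹} L-inverses R-inverses)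
    where
    open _∼_ P∼D using () renaming (P to L; P⁻¹ to L⁻¹; Q to R; Q⁻¹ to R⁻¹;
                                    P-inverses to L-inverses; Q-inverses to R-inverses; A≈PBQ to P≈LDR)
    d≈1 : d ≈ 1#
    d≈1 = begin
      d                  ≈⟨ det-D {m} d ⟨
      det (suc m) (D d)  ≈⟨ det-SLEquiv {A = P} {D d} (∼⇒SLEquiv P∼D) ⟨
      det (suc m) P      ≈⟨ P-SL ⟩
      1#                 ∎
    LR≈P : (L ⊗ R) ≈ᴹ P
    LR≈P = ≈ᴹ-sym (≈ᴹ-trans P≈LDR (⊗-congʳ {B = R} (≈ᴹ-trans (⊗-congˡ {A = L} (D≈I d≈1)) (⊗-identityʳ L))))

  det-zeroColumn : ∀ n (A : Matrix n) t → (∀ i → A i t ≈ 0#) → det n A ≈ 0#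
  det-zeroColumn n A t Aᵢₜ≈0 = begin
    det n A              ≈⟨ det-cong n A⊗Z≈A ⟨
    det n (A ⊗ Z)        ≈⟨ det-⊗ n A Z ⟩
    det n A * det n Z    ≈⟨ *-congˡ (det-zeroRow n Z t Zₜ≈0) ⟩
    det n A * 0#         ≈⟨ zeroʳ _ ⟩
    0#                   ∎
    where
    Z : Matrix n
    Z i j = δ i j * (1# - δ t j)
    Zₜ≈0 : ∀ j → Z t j ≈ 0#
    Zₜ≈0 j = trans (solve 1 (λ d → d :* (con (+ 1) :+ :- d) := d :+ :- (d :* d)) refl _)
                   (trans (+-congˡ (-‿cong (δ-idem t j))) (-‿inverseʳ _))
    A⊗Z≈A : (A ⊗ Z) ≈ᴹ A
    A⊗Z≈A i j = begin
      sumF n (λ k → A i k * (δ k j * (1# - δ t j)))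
        ≈⟨ sumF-cong n (λ k → solve 3 (λ a d x → a :* (d :* x) := (a :* x) :* d) refl _ _ _) ⟩
      sumF n (λ k → (A i k * (1# - δ t j)) * δ k j)
        ≈⟨ sumF-δʳ n j (λ k → A i k * (1# - δ t j)) ⟩
      A i j * (1# - δ t j)
        ≈⟨ solve 2 (λ a d → a :* (con (+ 1) :+ :- d) := a :+ :- (d :* a)) refl _ _ ⟩
      A i j - δ t j * A i j
        ≈⟨ +-congˡ (-‿cong (trans (δ-swap t j (A i)) (trans (*-congˡ (Aᵢₜ≈0 i)) (zeroʳ _)))) ⟩
      A i j - 0#
        ≈⟨ trans (+-congˡ -0#≈0#) (+-identityʳ _) ⟩
      A i j ∎

  ones : ∀ {n} → ℕ → Fin n → Carrier
  ones zero    i       = 0#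
  ones (suc r) zero    = 1#
  ones (suc r) (suc i) = ones r i

  E-diagonal : ∀ {n} r (i j : Fin n) → E r i j ≈ δ i j * ones r i
  E-diagonal {suc n} zero    i       j       = sym (zeroʳ _)
  E-diagonal {suc n} (suc r) zero    zero    = sym (*-identityˡ 1#)
  E-diagonal {suc n} (suc r) zero    (suc j) = sym (zeroˡ 1#)
  E-diagonal {suc n} (suc r) (suc i) zero    = sym (zeroˡ _)
  E-diagonal {suc n} (suc r) (suc i) (suc j) = E-diagonal r i j

  ones-idem : ∀ {n} r (i : Fin n) → ones r i * ones r i ≈ ones r i
  ones-idem zero    i       = zeroˡ 0#
  ones-idem (suc r) zero    = *-identityˡ 1#
  ones-idem (suc r) (suc i) = ones-idem r i

  ones-mono : ∀ {n} r s → r ≤ s → (i : Fin n) → ones r i * ones s i ≈ ones r i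
  ones-mono zero    s       _         i       = zeroˡ _
  ones-mono (suc r) (suc s) (s≤s r≤s) zero    = *-identityˡ 1#
  ones-mono (suc r) (suc s) (s≤s r≤s) (suc i) = ones-mono r s r≤s i

  ones-beyond : ∀ {n} r (i : Fin n) → r ≤ toℕ i → ones r i ≈ 0#
  ones-beyond zero    i       _         = refl
  ones-beyond (suc r) (suc i) (s≤s r≤i) = ones-beyond r i r≤i

  ones-within : ∀ {n} s (i : Fin n) → toℕ i < s → ones s i ≈ 1#
  ones-within (suc s) zero    _         = refl
  ones-within (suc s) (suc i) (s≤s i<s) = ones-within s i i<s

  -- From diag e = P diag ρ Q one builds X = diag e · P · diag ρ + diag (1 - e) and
  -- Y = diag ρ · Q · diag e + diag (1 - e) with X Y = I.
  private
    module DiagonalFactorisation {N} (P Q : Matrix N) (ρ e : Fin N → Carrier)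
      (ρ-idem : ∀ i → ρ i * ρ i ≈ ρ i) (e-idem : ∀ i → e i * e i ≈ e i) (ρ≤e : ∀ i → ρ i * e i ≈ ρ i)
      (factorisation : ∀ i j → δ i j * e i ≈ sumF N (λ k → (P i k * ρ k) * Q k j)) where

      z : Fin N → Carrier
      z i = 1# - e i

      ρz≈0 : ∀ i → ρ i * z i ≈ 0#
      ρz≈0 i = trans (solve 2 (λ r x → r :* (con (+ 1) :+ :- x) := r :+ :- (r :* x)) refl _ _)
                     (trans (+-congˡ (-‿cong (ρ≤e i))) (-‿inverseʳ _))

      z-idem : ∀ i → z i * z i ≈ z i
      z-idem i = begin
        z i * z i                        ≈⟨ solve 1 (λ x → (con (+ 1) :+ :- x) :* (con (+ 1) :+ :- x)
                                              := con (+ 1) :+ :- x :+ :- x :+ x :* x) refl _ ⟩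
        1# - e i - e i + e i * e i       ≈⟨ +-congˡ (e-idem i) ⟩
        1# - e i - e i + e i             ≈⟨ solve 1 (λ x → con (+ 1) :+ :- x :+ :- x :+ x
                                              := con (+ 1) :+ :- x) refl _ ⟩
        z i                              ∎

      X Y : Matrix N
      X i j = (e i * P i j) * ρ j + z i * δ i j
      Y i j = (ρ i * Q i j) * e j + z i * δ i j

      X⊗Y-term : ∀ i j k → X i k * Y k j ≈
        ((e i * e j) * ((P i k * ρ k) * Q k j) + ((e i * P i k) * (ρ k * z k)) * δ k j)
        + (δ i k * (z i * ((ρ k * Q k j) * e j)) + δ i k * (z i * (z k * δ k j)))
      X⊗Y-term i j k = trans
        (solve 9 (λ a b c r y d q y′ d′ → (a :* b :* r :+ y :* d) :* (r :* q :* c :+ y′ :* d′)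
                   := (a :* c) :* ((b :* (r :* r)) :* q) :+ (a :* b :* (r :* y′)) :* d′
                      :+ (d :* (y :* (r :* q :* c)) :+ d :* (y :* (y′ :* d′)))) refl
                 (e i) (P i k) (e j) (ρ k) (z i) (δ i k) (Q k j) (z k) (δ k j))
        (+-congʳ (+-congʳ (*-congˡ (*-congʳ (*-congˡ (ρ-idem k))))))

      X⊗Y≈I : (X ⊗ Y) ≈ᴹ I
      X⊗Y≈I i j = begin
        sumF N (λ k → X i k * Y k j)
          ≈⟨ trans (sumF-cong N (X⊗Y-term i j))
                   (trans (sumF-+ N _ _) (+-cong (sumF-+ N _ _) (sumF-+ N _ _))) ⟩
        (sumF N (λ k → (e i * e j) * ((P i k * ρ k) * Q k j))
          + sumF N (λ k → ((e i * P i k) * (ρ k * z k)) * δ k j))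
        + (sumF N (λ k → δ i k * (z i * ((ρ k * Q k j) * e j)))
          + sumF N (λ k → δ i k * (z i * (z k * δ k j))))
          ≈⟨ +-cong (+-cong (trans (sumF-*ˡ N _ _) (*-congˡ (sym (factorisation i j))))
                            (sumF-δʳ N j (λ k → (e i * P i k) * (ρ k * z k))))
                    (+-cong (sumF-δˡ N i (λ k → z i * ((ρ k * Q k j) * e j)))
                            (sumF-δˡ N i (λ k → z i * (z k * δ k j)))) ⟩
        ((e i * e j) * (δ i j * e i) + (e i * P i j) * (ρ j * z j))
        + (z i * ((ρ i * Q i j) * e j) + z i * (z i * δ i j))
          ≈⟨ +-cong (+-congˡ (trans (*-congˡ (ρz≈0 j)) (zeroʳ _)))
                    (+-congʳ (solve 4 (λ y r q x → y :* ((r :* q) :* x) := (r :* y) :* (q :* x))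
                                      refl _ _ _ _)) ⟩
        ((e i * e j) * (δ i j * e i) + 0#) + ((ρ i * z i) * (Q i j * e j) + z i * (z i * δ i j))
          ≈⟨ +-congˡ (+-congʳ (trans (*-congʳ (ρz≈0 i)) (zeroˡ _))) ⟩
        ((e i * e j) * (δ i j * e i) + 0#) + (0# + z i * (z i * δ i j))
          ≈⟨ solve 4 (λ a b d y → ((a :* b) :* (d :* a) :+ con (+ 0)) :+ (con (+ 0) :+ y :* (y :* d))
                                    := (a :* a) :* (d :* b) :+ (y :* y) :* d) refl _ _ _ _ ⟩
        (e i * e i) * (δ i j * e j) + (z i * z i) * δ i j
          ≈⟨ +-cong (*-cong (e-idem i) (δ-swap i j e)) (*-congʳ (z-idem i)) ⟩
        e i * (δ i j * e i) + z i * δ i j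
          ≈⟨ +-congʳ (trans (solve 2 (λ x d → x :* (d :* x) := d :* (x :* x)) refl _ _)
                            (*-congˡ (e-idem i))) ⟩
        δ i j * e i + z i * δ i j
          ≈⟨ solve 2 (λ d x → d :* x :+ (con (+ 1) :+ :- x) :* d := d) refl _ _ ⟩
        δ i j ∎

      X-column≈0 : ∀ t → ρ t ≈ 0# → e t ≈ 1# → ∀ i → X i t ≈ 0#
      X-column≈0 t ρₜ≈0 eₜ≈1 i = begin
        (e i * P i t) * ρ t + z i * δ i t   ≈⟨ +-cong (trans (*-congˡ ρₜ≈0) (zeroʳ _)) (*-comm (z i) (δ i t)) ⟩
        0# + δ i t * z i                    ≈⟨ +-congˡ (δ-swap i t z) ⟨
        0# + δ i t * z t                    ≈⟨ +-congˡ (*-congˡ zₜ≈0) ⟩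
        0# + δ i t * 0#                     ≈⟨ trans (+-identityˡ _) (zeroʳ _) ⟩
        0#                                  ∎
        where
        zₜ≈0 : z t ≈ 0#
        zₜ≈0 = trans (+-congˡ (-‿cong eₜ≈1)) (-‿inverseʳ 1#)

  -- X has a zero column but a right inverse, hence determinant both 0 and a unit.
  diagonal-rank-separation : ∀ {N} (P Q : Matrix N) (ρ e : Fin N → Carrier) (t : Fin N) →
    (∀ i → ρ i * ρ i ≈ ρ i) → (∀ i → e i * e i ≈ e i) → (∀ i → ρ i * e i ≈ ρ i) →
    ρ t ≈ 0# → e t ≈ 1# →
    ¬ (∀ i j → δ i j * e i ≈ sumF N (λ k → (P i k * ρ k) * Q k j))
  diagonal-rank-separation {N} P Q ρ e t ρ-idem e-idem ρ≤e ρₜ≈0 eₜ≈1 factorisation = 0≉1 (begin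
    0#                   ≈⟨ zeroˡ _ ⟨
    0# * det N Y         ≈⟨ *-congʳ (det-zeroColumn N X t (X-column≈0 t ρₜ≈0 eₜ≈1)) ⟨
    det N X * det N Y    ≈⟨ det-⊗ N X Y ⟨
    det N (X ⊗ Y)        ≈⟨ det-cong N X⊗Y≈I ⟩
    det N I              ≈⟨ det-identity N ⟩
    1#                   ∎)
    where open DiagonalFactorisation P Q ρ e ρ-idem e-idem ρ≤e factorisation

  E-separation : ∀ {N} (P Q : Matrix N) r s → r < s → s ≤ N → ¬ (E s ≈ᴹ ((P ⊗ E r) ⊗ Q))
  E-separation {N} P Q r s r<s s≤N Es≈PErQ = diagonal-rank-separation P Q (ones r) (ones s) t
    (ones-idem r) (ones-idem s) (ones-mono r s (ℕ.<⇒≤ r<s))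
    (ones-beyond r t (ℕ.≤-reflexive (≡.sym toℕ-t≡r)))
    (ones-within s t (≡.subst (_< s) (≡.sym toℕ-t≡r) r<s))
    factorisation
    where
    r<N : r < N
    r<N = ℕ.<-≤-trans r<s s≤N
    t : Fin N
    t = fromℕ< r<N
    toℕ-t≡r : toℕ t ≡ r
    toℕ-t≡r = Fin.toℕ-fromℕ< r<N
    factorisation : ∀ i j → δ i j * ones s i ≈ sumF N (λ k → (P i k * ones r k) * Q k j)
    factorisation i j = begin
      δ i j * ones s i                                       ≈⟨ E-diagonal s i j ⟨
      E s i j                                                ≈⟨ Es≈PErQ i j ⟩
      sumF N (λ k → sumF N (λ l → P i l * E r l k) * Q k j)  ≈⟨ sumF-cong N (λ k → *-congʳ (P⊗Er k)) ⟩
      sumF N (λ k → (P i k * ones r k) * Q k j)              ∎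
      where
      P⊗Er : ∀ k → sumF N (λ l → P i l * E r l k) ≈ P i k * ones r k
      P⊗Er k = trans (sumF-cong N (λ l → trans (*-congˡ (E-diagonal r l k))
                 (solve 3 (λ p d x → p :* (d :* x) := (p :* x) :* d) refl _ _ _)))
                 (sumF-δʳ N k (λ l → P i l * ones r l))

  E-injective : ∀ m r s → r < suc m → s < suc m → SLEquiv (E {suc m} r) (E s) → r ≡ s
  E-injective m r s r≤m s≤m (P , Q , P-SL , Q-SL , Er≈PEsQ) with ℕ.<-cmp r s
  ... | tri≈ _ r≡s _ = r≡s
  ... | tri> _ _ s<r = ⊥-elim (E-separation P Q s r s<r (ℕ.<⇒≤ r≤m) Er≈PEsQ)
  ... | tri< r<s _ _ with SL-invertible m P P-SL | SL-invertible m Q Q-SL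
  ...   | P⁻¹ , P-inverses | Q⁻¹ , Q-inverses = ⊥-elim (E-separation P⁻¹ Q⁻¹ r s r<s (ℕ.<⇒≤ s≤m)
          (cancel-PBQ {P = P} {P⁻¹} {Q} {Q⁻¹} (proj₂ P-inverses) (proj₁ Q-inverses) Er≈PEsQ))

  E≁D : ∀ m r d → r < suc m → ¬ (d ≈ 0#) → ¬ SLEquiv (E {suc m} r) (D d)
  E≁D m r d r≤m d≉0 Er∼Dd = d≉0 (begin
    d                   ≈⟨ det-D {m} d ⟨
    det (suc m) (D d)   ≈⟨ det-SLEquiv {A = E r} {D d} Er∼Dd ⟨
    det (suc m) (E r)   ≈⟨ det-E r r≤m ⟩
    0#                  ∎)

  D≁E : ∀ m r d → r < suc m → ¬ (d ≈ 0#) → ¬ SLEquiv (D {m} d) (E r)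
  D≁E m r d r≤m d≉0 Dd∼Er = d≉0 (begin
    d                   ≈⟨ det-D {m} d ⟨
    det (suc m) (D d)   ≈⟨ det-SLEquiv {A = D d} {E r} Dd∼Er ⟩
    det (suc m) (E r)   ≈⟨ det-E r r≤m ⟩
    0#                  ∎)

  D-injective : ∀ m d d′ → SLEquiv (D {m} d) (D d′) → d ≈ d′
  D-injective m d d′ Dd∼Dd′ = begin
    d                   ≈⟨ det-D {m} d ⟨
    det (suc m) (D d)   ≈⟨ det-SLEquiv {A = D d} {D d′} Dd∼Dd′ ⟩
    det (suc m) (D d′)  ≈⟨ det-D {m} d′ ⟩
    d′                  ∎

module Counting {c ℓ} (F : Field c ℓ) (q : ℕ) (finite : IsFiniteOfSize F (suc q)) where
  open Field F using (Carrier; _≈_; refl; sym; trans; 0#)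
  open IsFiniteOfSize finite

  enum-cong : ∀ {i j} → i ≡ j → enum i ≈ enum j
  enum-cong ≡.refl = refl

  _≟_ : Decidable _≈_
  x ≟ y with enum-surj x | enum-surj y
  ... | i , eᵢ≈x | j , eⱼ≈y = map′
    (λ i≡j → trans (sym eᵢ≈x) (trans (enum-cong i≡j) eⱼ≈y))
    (λ x≈y → enum-inj i j (trans eᵢ≈x (trans x≈y (sym eⱼ≈y))))
    (i Fin.≟ j)

  open MatrixOps F using (Matrix; SLEquiv; NumClasses)
  open NormalForm F _≟_ using (E; D; normalForm)
  open SLEquivalence F _≟_ using (_∼_; ∼⇒SLEquiv; ∼-trans; ∼-reflexive)
  open Separation F _≟_ using (D-cong; E-injective; E≁D; D≁E; D-injective)

  index₀ : Fin (suc q)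
  index₀ = proj₁ (enum-surj 0#)

  nonzero : Fin q → Carrier
  nonzero t = enum (punchIn index₀ t)

  nonzero-≉0 : ∀ t → ¬ (nonzero t ≈ 0#)
  nonzero-≉0 t eₜ≈0 = Fin.punchInᵢ≢i index₀ t (enum-inj _ _ (trans eₜ≈0 (sym (proj₂ (enum-surj 0#)))))

  nonzero-injective : ∀ t t′ → nonzero t ≈ nonzero t′ → t ≡ t′
  nonzero-injective t t′ eₜ≈eₜ′ = Fin.punchIn-injective index₀ t t′ (enum-inj _ _ eₜ≈eₜ′)

  nonzero-surjective : ∀ d → ¬ (d ≈ 0#) → ∃ λ t → nonzero t ≈ d
  nonzero-surjective d d≉0 with enum-surj d
  ... | i , eᵢ≈d = punchOut index₀≢i , trans (enum-cong (Fin.punchIn-punchOut index₀≢i)) eᵢ≈d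
    where
    index₀≢i : index₀ ≢ i
    index₀≢i index₀≡i = d≉0 (trans (sym eᵢ≈d) (trans (enum-cong (≡.sym index₀≡i)) (proj₂ (enum-surj 0#))))

  module _ (m : ℕ) where
    representative : Fin (suc m) ⊎ Fin q → Matrix (suc m)
    representative (inj₁ r) = E (toℕ r)
    representative (inj₂ t) = D (nonzero t)

    covers : ∀ A → ∃ λ x → A ∼ representative x
    covers A with normalForm m A
    ... | inj₁ (r , r≤m , A∼E) = inj₁ (fromℕ< r≤m) ,
          ≡.subst (λ k → A ∼ E k) (≡.sym (Fin.toℕ-fromℕ< r≤m)) A∼E
    ... | inj₂ (d , d≉0 , A∼D) with nonzero-surjective d d≉0
    ...   | t , eₜ≈d = inj₂ t , ∼-trans A∼D (∼-reflexive (D-cong (sym eₜ≈d)))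

    distinct : ∀ x y → SLEquiv (representative x) (representative y) → x ≡ y
    distinct (inj₁ r) (inj₁ s) Er∼Es = ≡.cong inj₁ (Fin.toℕ-injective
      (E-injective m (toℕ r) (toℕ s) (Fin.toℕ<n r) (Fin.toℕ<n s) Er∼Es))
    distinct (inj₁ r) (inj₂ t) Er∼D = ⊥-elim (E≁D m (toℕ r) (nonzero t) (Fin.toℕ<n r) (nonzero-≉0 t) Er∼D)
    distinct (inj₂ t) (inj₁ r) D∼Er = ⊥-elim (D≁E m (toℕ r) (nonzero t) (Fin.toℕ<n r) (nonzero-≉0 t) D∼Er)
    distinct (inj₂ t) (inj₂ u) D∼D = ≡.cong inj₂
      (nonzero-injective t u (D-injective m (nonzero t) (nonzero u) D∼D))

    numClasses : NumClasses (suc m) (suc m ℕ.+ q)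
    numClasses = representative ∘ splitAt (suc m) , covers′ , distinct′
      where
      covers′ : ∀ A → ∃ λ i → SLEquiv A (representative (splitAt (suc m) i))
      covers′ A with covers A
      ... | x , A∼x = join (suc m) q x , ≡.subst (λ y → SLEquiv A (representative y))
                                                (≡.sym (Fin.splitAt-join (suc m) q x)) (∼⇒SLEquiv A∼x)

      distinct′ : ∀ i j → SLEquiv (representative (splitAt (suc m) i))
                                  (representative (splitAt (suc m) j)) → i ≡ j
      distinct′ i j rᵢ∼rⱼ = begin
        i                                   ≡⟨ Fin.join-splitAt (suc m) q i ⟨
        join (suc m) q (splitAt (suc m) i)  ≡⟨ ≡.cong (join (suc m) q) splitAt-i≡splitAt-j ⟩
        join (suc m) q (splitAt (suc m) j)  ≡⟨ Fin.join-splitAt (suc m) q j ⟩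
        j                                   ∎
        where
        open ≡.≡-Reasoning
        splitAt-i≡splitAt-j : splitAt (suc m) i ≡ splitAt (suc m) j
        splitAt-i≡splitAt-j = distinct (splitAt (suc m) i) (splitAt (suc m) j) rᵢ∼rⱼ

open import Data.Nat.Base using (_+_; _∸_; _≥_)
open import Data.Nat.Properties using (+-suc)

mainTheorem16 : ∀ {c ℓ} (F : Field c ℓ) (q : ℕ) → IsFiniteOfSize F q →
                (n : ℕ) → n ≥ 1 →
                MatrixOps.NumClasses F n (n + q ∸ 1)
mainTheorem16 F zero    finite n       _ with () ← proj₁ (IsFiniteOfSize.enum-surj finite (Field.0# F))
mainTheorem16 F (suc q) finite (suc m) _ =
  ≡.subst (MatrixOps.NumClasses F (suc m)) (≡.sym (+-suc m q)) (Counting.numClasses F q finite m)
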